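{- Let $M=(E,\mathcal{B})$ be an even symmetric matroid on $E=[n]\cup[n]^*$. Then there is a unique $\mathcal{B}'\subseteq\mathcal{A}_n$ such that $(E,\mathcal{B}\cup\mathcal{B}')$ is an antisymmetric matroid.
   Context: $E=[n]\cup[n]^*$ with involution $i\leftrightarrow i^*$; a skew pair is $\{i,i^*\}$; $\mathcal{T}_n$ (transversals) are $n$-subsets of $E$ with no skew pair, $\mathcal{A}_n$ (almost-transversals) $n$-subsets with exactly one skew pair. A symmetric matroid is $(E,\mathcal{B})$ with $\emptyset\ne\mathcal{B}\subseteq\mathcal{T}_n$ such that for all $B_1,B_2\in\mathcal{B}$ and $x\in B_1\setminus B_2$ there is $y\in B_1\setminus B_2$ (possibly $y=x$) with $B_1\triangle\{x,x^*,y,y^*\}\in\mathcal{B}$; it is even if $|B\cap[n]|$ has the same parity for all $B\in\mathcal{B}$. An antisymmetric matroid on $E$ is $(E,\mathcal{B}'')$ with $\mathcal{B}''\subseteq\mathcal{T}_n\cup\mathcal{A}_n$ satisfying (B1) $\mathcal{B}''\ne\emptyset$; (B2) for $T\in\mathcal{T}_n$ and distinct skew pairs $p,q$, $(T\cup p)\setminus q\in\mathcal{B}''$ iff $(T\cup q)\setminus p\in\mathcal{B}''$; (Exch) for $B,B'\in\mathcal{B}''$ and $e\in B\setminus B'$ with $B\setminus\{e\}$ having no skew pair and $B'\cup\{e\}$ having exactly one skew pair, there is $f\in B'\setminus B$ with both $(B\setminus\{e\})\cup\{f\}$ and $(B'\cup\{e\})\setminus\{f\}$ in $\mathcal{B}''$.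 -}

module Defs where

open import Data.Nat using (ℕ; zero; suc; _+_; _%_)
open import Data.Bool using (Bool; true; false; not; _∧_; _∨_; _xor_; if_then_else_)
open import Data.Fin using (Fin)
import Data.Fin as Fin
import Data.Bool as B
open import Data.Vec using (Vec; []; _∷_; lookup; tabulate)
import Data.Sum
open import Data.Product using (_×_; _,_; proj₁; proj₂; ∃; ∃-syntax)
open import Relation.Nullary using (¬_)
open import Relation.Nullary.Decidable using (⌊_⌋)
open import Relation.Binary.PropositionalEquality using (_≡_)

-- Ground set E = [n] ∪ [n]* : (i , false) is i, (i , true) is i*.
E : ℕ → Set
E n = Fin n × Bool

star : ∀ {n} → E n → E n
star (i , b) = (i , not b)

_==_ : ∀ {n} → E n → E n → Bool
(i , b) == (j , c) = ⌊ i Fin.≟ j ⌋ ∧ ⌊ b B.≟ c ⌋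

-- Subsets of E: (characteristic vector of S ∩ [n] , characteristic vector of S ∩ [n]*)
Sub : ℕ → Set
Sub n = Vec Bool n × Vec Bool n

mem : ∀ {n} → Sub n → E n → Bool
mem S (i , false) = lookup (proj₁ S) i
mem S (i , true)  = lookup (proj₂ S) i

_∈ₛ_ : ∀ {n} → E n → Sub n → Set
e ∈ₛ S = mem S e ≡ true

_∉ₛ_ : ∀ {n} → E n → Sub n → Set
e ∉ₛ S = mem S e ≡ false

build : ∀ {n} → (E n → Bool) → Sub n
build f = tabulate (λ i → f (i , false)) , tabulate (λ i → f (i , true))

_∪ₛ_ : ∀ {n} → Sub n → Sub n → Sub n
S ∪ₛ T = build (λ x → mem S x ∨ mem T x)

_∖ₛ_ : ∀ {n} → Sub n → Sub n → Sub n
S ∖ₛ T = build (λ x → mem S x ∧ not (mem T x))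

_△ₛ_ : ∀ {n} → Sub n → Sub n → Sub n
S △ₛ T = build (λ x → mem S x xor mem T x)

⁅_⁆ₛ : ∀ {n} → E n → Sub n
⁅ e ⁆ₛ = build (λ x → x == e)

skew : ∀ {n} → Fin n → Sub n
skew i = build (λ x → ⌊ proj₁ x Fin.≟ i ⌋)

quad : ∀ {n} → E n → E n → Sub n
quad x y = build (λ z → (z == x) ∨ (z == star x) ∨ (z == y) ∨ (z == star y))

countV : ∀ {m} → Vec Bool m → ℕ
countV [] = 0
countV (true ∷ v) = suc (countV v)
countV (false ∷ v) = countV v

size : ∀ {n} → Sub n → ℕ
size S = countV (proj₁ S) + countV (proj₂ S)

sizeUnstarred : ∀ {n} → Sub n → ℕ
sizeUnstarred S = countV (proj₁ S)

HasSkewAt : ∀ {n} → Sub n → Fin n → Set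
HasSkewAt S i = ((i , false) ∈ₛ S) × ((i , true) ∈ₛ S)

NoSkewPair : ∀ {n} → Sub n → Set
NoSkewPair {n} S = (i : Fin n) → ¬ HasSkewAt S i

ExactlyOneSkewPair : ∀ {n} → Sub n → Set
ExactlyOneSkewPair {n} S = ∃[ i ] (HasSkewAt S i × ((j : Fin n) → HasSkewAt S j → j ≡ i))

Transversal : ∀ {n} → Sub n → Set
Transversal {n} S = size S ≡ n × NoSkewPair S

AlmostTransversal : ∀ {n} → Sub n → Set
AlmostTransversal {n} S = size S ≡ n × ExactlyOneSkewPair S

Family : ℕ → Set
Family n = Sub n → Bool

_∈𝓕_ : ∀ {n} → Sub n → Family n → Set
X ∈𝓕 𝓑 = 𝓑 X ≡ true

_∪𝓕_ : ∀ {n} → Family n → Family n → Family n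
(𝓑 ∪𝓕 𝓑') X = 𝓑 X ∨ 𝓑' X

record IsSymmetricMatroid {n : ℕ} (𝓑 : Family n) : Set where
  field
    nonempty : ∃[ B ] (B ∈𝓕 𝓑)
    transversals : ∀ B → B ∈𝓕 𝓑 → Transversal B
    exchange : ∀ B₁ B₂ → B₁ ∈𝓕 𝓑 → B₂ ∈𝓕 𝓑 →
      ∀ x → x ∈ₛ B₁ → x ∉ₛ B₂ →
      ∃[ y ] (y ∈ₛ B₁ × y ∉ₛ B₂ × ((B₁ △ₛ quad x y) ∈𝓕 𝓑))

IsEven : ∀ {n} → Family n → Set
IsEven 𝓑 = ∀ B₁ B₂ → B₁ ∈𝓕 𝓑 → B₂ ∈𝓕 𝓑 → sizeUnstarred B₁ % 2 ≡ sizeUnstarred B₂ % 2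

IsEvenSymmetricMatroid : ∀ {n} → Family n → Set
IsEvenSymmetricMatroid 𝓑 = IsSymmetricMatroid 𝓑 × IsEven 𝓑

record IsAntisymmetricMatroid {n : ℕ} (𝓑 : Family n) : Set where
  field
    ⊆𝒯∪𝒜 : ∀ B → B ∈𝓕 𝓑 → Transversal B Data.Sum.⊎ AlmostTransversal B
    B1 : ∃[ B ] (B ∈𝓕 𝓑)
    B2 : ∀ T → Transversal T → (i j : Fin n) → ¬ (i ≡ j) →
      (((T ∪ₛ skew i) ∖ₛ skew j) ∈𝓕 𝓑 → ((T ∪ₛ skew j) ∖ₛ skew i) ∈𝓕 𝓑) ×
      (((T ∪ₛ skew j) ∖ₛ skew i) ∈𝓕 𝓑 → ((T ∪ₛ skew i) ∖ₛ skew j) ∈𝓕 𝓑)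
    Exch : ∀ B B' → B ∈𝓕 𝓑 → B' ∈𝓕 𝓑 →
      ∀ e → e ∈ₛ B → e ∉ₛ B' →
      NoSkewPair (B ∖ₛ ⁅ e ⁆ₛ) → ExactlyOneSkewPair (B' ∪ₛ ⁅ e ⁆ₛ) →
      ∃[ f ] (f ∈ₛ B' × f ∉ₛ B ×
              (((B ∖ₛ ⁅ e ⁆ₛ) ∪ₛ ⁅ f ⁆ₛ) ∈𝓕 𝓑) ×
              (((B' ∪ₛ ⁅ e ⁆ₛ) ∖ₛ ⁅ f ⁆ₛ) ∈𝓕 𝓑))

-- Encode a transversal T by σ : Fin n → Bool, where σ i = true iff i* ∈ T. The transversal bases of 𝓑
-- then form an even Δ-matroid on Boolean vectors: flipping one coordinate changes |T ∩ [n]| by one, and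
-- the symmetric exchange axiom flips two coordinates of a basis towards another one. Even Δ-matroids have
-- the simultaneous exchange property (by induction on the Hamming distance): if f and g are feasible and
-- f u ≠ g u, some l ≠ u with f l ≠ g l makes both f and g flipped at {u, l} feasible.
--
-- The completion 𝓑′ consists of the almost-transversals (T ∪ {p, p*}) ∖ {q, q*} such that T and
-- T △ {p, p*, q, q*} are both bases. Each of the four kinds of antisymmetric exchange (transversal or
-- almost-transversal on either side) is a single simultaneous exchange, and B2 holds because the condition
-- is symmetric in p and q. For uniqueness, let 𝓑 ∪ 𝓒 be antisymmetric: exchanging between T and
-- T △ {p, p*, q, q*} forces (T ∪ {p, p*}) ∖ {q, q*} into 𝓒, and exchanging between a member of 𝓒 and its
-- B2-partner produces the two bases that put it into 𝓑′.

module Submission where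

open import Defs
open import Data.Nat using (ℕ; zero; suc; _+_; _%_; _≤_; _<_; z≤n; s≤s)
import Data.Nat.Properties as ℕₚ
open import Data.Bool using (Bool; true; false; not; _∧_; _∨_; _xor_; if_then_else_)
open import Data.Bool.Properties using (∧-identityʳ; ∨-identityʳ; ∧-inverseʳ; ∨-zeroʳ; ∧-zeroʳ; ¬-not; not-¬)
import Data.Bool.Properties as Boolₚ
open import Data.Bool.Solver using (module xor-∧-Solver)
open import Data.Fin using (Fin; zero; suc; _≟_)
import Data.Fin.Properties as Finₚ
open import Data.Vec using (Vec; []; _∷_; lookup)
open import Data.Vec.Properties using (lookup∘tabulate)
import Data.Vec.Properties as Vecₚ
import Data.Product.Properties as ×ₚ
open import Data.Vec.Functional using (Vector)
open import Data.Vec.Relation.Binary.Pointwise.Extensional using (ext; Pointwise-≡⇒≡)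
open import Data.Product using (_×_; _,_; proj₁; proj₂; ∃-syntax)
open import Data.Sum using (_⊎_; inj₁; inj₂)
open import Data.Empty using (⊥-elim)
open import Function using (_∘_; mk⇔)
open import Relation.Nullary using (¬_; yes; no; Dec; _×-dec_; _⊎-dec_; ¬?)
open import Relation.Nullary.Decidable using (⌊_⌋; isYes≗does; dec-true; dec-false; decidable-stable; map′)
open import Data.Nat.Induction using (<-rec)
open import Relation.Binary.PropositionalEquality
  using (_≡_; _≢_; _≗_; refl; sym; trans; cong; cong₂; subst; subst₂; ≢-sym; module ≡-Reasoning)
open import Algebra.Properties.CommutativeMonoid.Sum ℕₚ.+-0-commutativeMonoid using (sum; sum-cong-≗)
open import Algebra.Properties.CommutativeSemigroup ℕₚ.+-commutativeSemigroup using (interchange; xy∙z≈zy∙x)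

private
  variable
    n : ℕ

bit : Bool → ℕ
bit true = 1
bit false = 0

true≢false : true ≢ false
true≢false ()

⌊⌋-yes : ∀ {P : Set} (d : Dec P) → P → ⌊ d ⌋ ≡ true
⌊⌋-yes d p = trans (isYes≗does d) (dec-true d p)

⌊⌋-no : ∀ {P : Set} (d : Dec P) → ¬ P → ⌊ d ⌋ ≡ false
⌊⌋-no d ¬p = trans (isYes≗does d) (dec-false d ¬p)

⌊⌋-sound : ∀ {P : Set} (d : Dec P) → ⌊ d ⌋ ≡ true → P
⌊⌋-sound (yes p) _ = p

⌊true≟⌋ : ∀ s → ⌊ true Boolₚ.≟ s ⌋ ≡ s
⌊true≟⌋ true = refl
⌊true≟⌋ false = refl

⌊false≟⌋ : ∀ s → ⌊ false Boolₚ.≟ s ⌋ ≡ not s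
⌊false≟⌋ true = refl
⌊false≟⌋ false = refl

⌊≟not⌋ : ∀ b s → ⌊ b Boolₚ.≟ not s ⌋ ≡ not ⌊ b Boolₚ.≟ s ⌋
⌊≟not⌋ true s = trans (⌊true≟⌋ (not s)) (cong not (sym (⌊true≟⌋ s)))
⌊≟not⌋ false s = trans (⌊false≟⌋ (not s)) (cong not (sym (⌊false≟⌋ s)))

⌊≟⌋-∨-⌊≟not⌋ : ∀ b s → ⌊ b Boolₚ.≟ s ⌋ ∨ ⌊ b Boolₚ.≟ not s ⌋ ≡ true
⌊≟⌋-∨-⌊≟not⌋ true true = refl
⌊≟⌋-∨-⌊≟not⌋ true false = refl
⌊≟⌋-∨-⌊≟not⌋ false true = refl
⌊≟⌋-∨-⌊≟not⌋ false false = refl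

⌊≟⌋∧true-∨-⌊≟not⌋ : ∀ b s → (⌊ b Boolₚ.≟ s ⌋ ∧ true) ∨ ⌊ b Boolₚ.≟ not s ⌋ ≡ true
⌊≟⌋∧true-∨-⌊≟not⌋ b s = trans (cong (_∨ ⌊ b Boolₚ.≟ not s ⌋) (∧-identityʳ _)) (⌊≟⌋-∨-⌊≟not⌋ b s)

∧-trueˡ : ∀ {x y} → x ∧ y ≡ true → x ≡ true
∧-trueˡ {true} _ = refl

x∧true∨false : ∀ x → (x ∧ true) ∨ false ≡ x
x∧true∨false x = trans (∨-identityʳ _) (∧-identityʳ x)

x∧notx∨false : ∀ x → (x ∧ not x) ∨ false ≡ false
x∧notx∨false x = trans (∨-identityʳ _) (∧-inverseʳ x)

≢⇒not : ∀ {x y : Bool} → x ≢ y → not x ≡ y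
≢⇒not x≢y = sym (¬-not (≢-sym x≢y))

∃Bool? : {P : Bool → Set} → (∀ b → Dec (P b)) → Dec (∃[ b ] P b)
∃Bool? P? = map′ (λ { (inj₁ p) → true , p ; (inj₂ p) → false , p }) (λ { (true , p) → inj₁ p ; (false , p) → inj₂ p })
                 (P? true ⊎-dec P? false)

sum-1 : ∀ n → sum {n} (λ _ → 1) ≡ n
sum-1 zero = refl
sum-1 (suc n) = cong suc (sum-1 n)

sum-+ : (f g : Vector ℕ n) → sum (λ i → f i + g i) ≡ sum f + sum g
sum-+ {zero} f g = refl
sum-+ {suc n} f g =
  trans (cong (f zero + g zero +_) (sum-+ (f ∘ suc) (g ∘ suc))) (interchange (f zero) (g zero) _ _)

sum-mono-≤ : {f g : Vector ℕ n} → (∀ i → f i ≤ g i) → sum f ≤ sum g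
sum-mono-≤ {zero} f≤g = z≤n
sum-mono-≤ {suc n} f≤g = ℕₚ.+-mono-≤ (f≤g zero) (sum-mono-≤ (f≤g ∘ suc))

sum-mono-< : {f g : Vector ℕ n} → (∀ i → f i ≤ g i) → ∀ i → f i < g i → sum f < sum g
sum-mono-< f≤g zero fi<gi = ℕₚ.+-mono-<-≤ fi<gi (sum-mono-≤ (f≤g ∘ suc))
sum-mono-< f≤g (suc i) fi<gi = ℕₚ.+-mono-≤-< (f≤g zero) (sum-mono-< (f≤g ∘ suc) i fi<gi)

sum-differ-at : {f g : Vector ℕ n} (i : Fin n) → (∀ j → j ≢ i → f j ≡ g j) → sum f + g i ≡ sum g + f i
sum-differ-at {f = f} {g} zero f≡g rewrite sum-cong-≗ (λ j → f≡g (suc j) λ ()) =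
  xy∙z≈zy∙x (f zero) (sum (g ∘ suc)) (g zero)
sum-differ-at {f = f} {g} (suc i) f≡g rewrite f≡g zero (λ ()) =
  trans (ℕₚ.+-assoc (g zero) _ _)
    (trans (cong (g zero +_) (sum-differ-at i (λ j j≢i → f≡g (suc j) (j≢i ∘ Finₚ.suc-injective))))
      (sym (ℕₚ.+-assoc (g zero) _ _)))

%2-suc : ∀ m → suc m % 2 ≢ m % 2
%2-suc zero ()
%2-suc (suc zero) ()
%2-suc (suc (suc m)) eq = %2-suc m eq

%2-differ : ∀ a b x → a + bit x ≡ b + bit (not x) → a % 2 ≢ b % 2
%2-differ a b true eq a≡b =
  %2-suc a (trans (cong (_% 2) (trans (ℕₚ.+-comm 1 a) (trans eq (ℕₚ.+-identityʳ b)))) (sym a≡b))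
%2-differ a b false eq a≡b =
  %2-suc b (trans (cong (_% 2) (trans (ℕₚ.+-comm 1 b) (trans (sym eq) (ℕₚ.+-identityʳ a)))) a≡b)

-- Flipping coordinates of Boolean vectors

flip : Vector Bool n → Fin n → Vector Bool n
flip σ k m = ⌊ m ≟ k ⌋ xor σ m

flip₂ : Vector Bool n → Fin n → Fin n → Vector Bool n
flip₂ σ k l = flip (flip σ k) l

flip-at : ∀ σ (k : Fin n) → flip σ k k ≡ not (σ k)
flip-at σ k rewrite ⌊⌋-yes (k ≟ k) refl = refl

flip-off : ∀ σ {k m : Fin n} → m ≢ k → flip σ k m ≡ σ m
flip-off σ {k} {m} m≢k rewrite ⌊⌋-no (m ≟ k) m≢k = refl

flip-support : ∀ (σ τ : Vector Bool n) {k m} → flip σ k m ≢ τ m → m ≡ k ⊎ σ m ≢ τ m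
flip-support σ τ {k} {m} differ with m ≟ k
... | yes m≡k = inj₁ m≡k
... | no _ = inj₂ differ

flip-cong : ∀ {σ τ} (k : Fin n) → σ ≗ τ → flip σ k ≗ flip τ k
flip-cong k σ≗τ m = cong (⌊ m ≟ k ⌋ xor_) (σ≗τ m)

flip₂-atˡ : ∀ σ {k l : Fin n} → k ≢ l → flip₂ σ k l k ≡ not (σ k)
flip₂-atˡ σ {k} k≢l = trans (flip-off (flip σ k) k≢l) (flip-at σ k)

flip₂-atʳ : ∀ σ {k l : Fin n} → k ≢ l → flip₂ σ k l l ≡ not (σ l)
flip₂-atʳ σ {k} {l} k≢l = trans (flip-at (flip σ k) l) (cong not (flip-off σ (≢-sym k≢l)))

flip₂-off : ∀ σ {k l m : Fin n} → m ≢ k → m ≢ l → flip₂ σ k l m ≡ σ m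
flip₂-off σ {k} m≢k m≢l = trans (flip-off (flip σ k) m≢l) (flip-off σ m≢k)

flip₂-support : ∀ (σ τ : Vector Bool n) {k l m} → flip₂ σ k l m ≢ τ m → m ≡ l ⊎ m ≡ k ⊎ σ m ≢ τ m
flip₂-support σ τ {k} {l} {m} differ with flip-support (flip σ k) τ {l} {m} differ
... | inj₁ m≡l = inj₁ m≡l
... | inj₂ differ′ = inj₂ (flip-support σ τ {k} {m} differ′)

flip₂²-support : ∀ (σ : Vector Bool n) {a b c d i} → flip₂ (flip₂ σ a b) c d i ≢ σ i →
                 i ≡ d ⊎ i ≡ c ⊎ i ≡ b ⊎ i ≡ a
flip₂²-support σ {a} {b} differ with flip₂-support (flip₂ σ a b) σ differ
... | inj₁ i≡d = inj₁ i≡d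
... | inj₂ (inj₁ i≡c) = inj₂ (inj₁ i≡c)
... | inj₂ (inj₂ differ′) with flip₂-support σ σ differ′
...   | inj₁ i≡b = inj₂ (inj₂ (inj₁ i≡b))
...   | inj₂ (inj₁ i≡a) = inj₂ (inj₂ (inj₂ i≡a))
...   | inj₂ (inj₂ σi≢σi) = ⊥-elim (σi≢σi refl)

flip₂²-flips : ∀ (σ : Vector Bool n) {a b c d} → c ≢ a → c ≢ b → c ≢ d → σ c ≢ flip₂ (flip₂ σ a b) c d c
flip₂²-flips σ {a} {b} c≢a c≢b c≢d σc≡ =
  not-¬ refl (trans σc≡ (trans (flip₂-atˡ (flip₂ σ a b) c≢d) (cong not (flip₂-off σ c≢a c≢b))))

-- Identities in the group (ℤ/2)ⁿ generated by the flips, checked by the solver for Boolean rings.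
flip₂-comm : ∀ σ (k l : Fin n) → flip₂ σ k l ≗ flip₂ σ l k
flip₂-comm σ k l m = solve 3 (λ K L s → L :+ (K :+ s) := K :+ (L :+ s)) refl ⌊ m ≟ k ⌋ ⌊ m ≟ l ⌋ (σ m)
  where open xor-∧-Solver

flip₂-involutive : ∀ σ (k l : Fin n) → flip₂ (flip₂ σ k l) k l ≗ σ
flip₂-involutive σ k l m = solve 3 (λ K L s → L :+ (K :+ (L :+ (K :+ s))) := s) refl ⌊ m ≟ k ⌋ ⌊ m ≟ l ⌋ (σ m)
  where open xor-∧-Solver

flip₂-chain : ∀ σ (k l m : Fin n) → flip₂ (flip₂ σ k l) l m ≗ flip₂ σ k m
flip₂-chain σ k l m i =
  solve 4 (λ K L M s → M :+ (L :+ (L :+ (K :+ s))) := M :+ (K :+ s)) refl ⌊ i ≟ k ⌋ ⌊ i ≟ l ⌋ ⌊ i ≟ m ⌋ (σ i)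
  where open xor-∧-Solver

flip₂-chain′ : ∀ σ (k l m : Fin n) → flip₂ (flip₂ σ k l) m l ≗ flip₂ σ m k
flip₂-chain′ σ k l m i =
  solve 4 (λ K L M s → L :+ (M :+ (L :+ (K :+ s))) := K :+ (M :+ s)) refl ⌊ i ≟ k ⌋ ⌊ i ≟ l ⌋ ⌊ i ≟ m ⌋ (σ i)
  where open xor-∧-Solver

reset : Vector Bool n → Fin n → Fin n → Bool → Bool → Vector Bool n
reset σ p q b c m = if ⌊ m ≟ p ⌋ then b else if ⌊ m ≟ q ⌋ then c else σ m

reset-off : ∀ σ {p q m : Fin n} b c → m ≢ p → m ≢ q → reset σ p q b c m ≡ σ m
reset-off σ {p} {q} {m} b c m≢p m≢q rewrite ⌊⌋-no (m ≟ p) m≢p | ⌊⌋-no (m ≟ q) m≢q = refl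

reset-flip₂ : ∀ σ {p q : Fin n} → p ≢ q → reset σ p q (not (σ p)) (not (σ q)) ≗ flip₂ σ p q
reset-flip₂ σ {p} {q} p≢q m with m ≟ p | m ≟ q
... | yes refl | yes refl = ⊥-elim (p≢q refl)
... | yes refl | no _ = refl
... | no _ | yes refl = refl
... | no _ | no _ = refl

dist : Vector Bool n → Vector Bool n → ℕ
dist f g = sum λ i → if ⌊ f i Boolₚ.≟ g i ⌋ then 0 else 1

dist-< : ∀ {f g f′ g′ : Vector Bool n} → (∀ i → f′ i ≢ g′ i → f i ≢ g i) →
         ∀ z → f′ z ≡ g′ z → f z ≢ g z → dist f′ g′ < dist f g
dist-< {f = f} {g} {f′} {g′} shrinks z agree differ = sum-mono-< pointwise z at-z
  where
  pointwise : ∀ i → (if ⌊ f′ i Boolₚ.≟ g′ i ⌋ then 0 else 1) ≤ (if ⌊ f i Boolₚ.≟ g i ⌋ then 0 else 1)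
  pointwise i with f′ i Boolₚ.≟ g′ i | f i Boolₚ.≟ g i
  ... | yes _ | _ = z≤n
  ... | no f′≢g′ | yes f≡g = ⊥-elim (shrinks i f′≢g′ f≡g)
  ... | no _ | no _ = ℕₚ.≤-refl
  at-z : (if ⌊ f′ z Boolₚ.≟ g′ z ⌋ then 0 else 1) < (if ⌊ f z Boolₚ.≟ g z ⌋ then 0 else 1)
  at-z rewrite ⌊⌋-yes (f′ z Boolₚ.≟ g′ z) agree | ⌊⌋-no (f z Boolₚ.≟ g z) differ = s≤s z≤n

flip₂-fixesˡ : ∀ {f g : Vector Bool n} {a b} → a ≢ b → f a ≢ g a → flip₂ f a b a ≡ g a
flip₂-fixesˡ {f = f} a≢b differ = trans (flip₂-atˡ f a≢b) (≢⇒not differ)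

flip₂-fixesʳ : ∀ {f g : Vector Bool n} {a b} → a ≢ b → f b ≢ g b → flip₂ f a b b ≡ g b
flip₂-fixesʳ {f = f} a≢b differ = trans (flip₂-atʳ f a≢b) (≢⇒not differ)

dist-flip₂-< : ∀ {f g : Vector Bool n} {a b} → a ≢ b → f a ≢ g a → f b ≢ g b → dist (flip₂ f a b) g < dist f g
dist-flip₂-< {f = f} {g} {a} {b} a≢b fa≢ga fb≢gb = dist-< shrinks a (flip₂-fixesˡ {f = f} {g} a≢b fa≢ga) fa≢ga
  where
  shrinks : ∀ i → flip₂ f a b i ≢ g i → f i ≢ g i
  shrinks i differ with flip₂-support f g differ
  ... | inj₁ refl = fb≢gb
  ... | inj₂ (inj₁ refl) = fa≢ga
  ... | inj₂ (inj₂ fi≢gi) = fi≢gi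

flip₂-remaining : ∀ {f g : Vector Bool n} {a b i} → a ≢ b → f a ≢ g a → f b ≢ g b →
                  flip₂ f a b i ≢ g i → i ≢ a × i ≢ b × f i ≢ g i
flip₂-remaining {f = f} {g} {a} {b} {i} a≢b fa≢ga fb≢gb differ = i≢a , i≢b , differ ∘ trans (flip₂-off f i≢a i≢b)
  where
  i≢a : i ≢ a
  i≢a refl = differ (flip₂-fixesˡ {f = f} {g} a≢b fa≢ga)
  i≢b : i ≢ b
  i≢b refl = differ (flip₂-fixesʳ {f = f} {g} a≢b fb≢gb)

differ-alike : ∀ {f g h : Vector Bool n} → (∀ i → f i ≢ g i → f i ≢ h i) → (∀ i → f i ≢ h i → f i ≢ g i) → g ≗ h
differ-alike {f = f} {g} {h} g⇒h h⇒g i with f i Boolₚ.≟ g i | f i Boolₚ.≟ h i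
... | yes f≡g | yes f≡h = trans (sym f≡g) f≡h
... | yes f≡g | no f≢h = ⊥-elim (h⇒g i f≢h f≡g)
... | no f≢g | yes f≡h = ⊥-elim (g⇒h i f≢g f≡h)
... | no f≢g | no f≢h = trans (sym (≢⇒not f≢g)) (≢⇒not f≢h)

-- Even Δ-matroids have the simultaneous exchange property

module SimultaneousExchange
  {n : ℕ} (Feasible : Vector Bool n → Set)
  (feasible-resp : ∀ {σ τ} → σ ≗ τ → Feasible σ → Feasible τ)
  (exchange : ∀ {β β′} → Feasible β → Feasible β′ → ∀ {k} → β k ≢ β′ k →
              ∃[ l ] (l ≢ k × β l ≢ β′ l × Feasible (flip₂ β k l)))
  where

  Simultaneous : Vector Bool n → Vector Bool n → Fin n → Set
  Simultaneous f g u = ∃[ l ] (l ≢ u × f l ≢ g l × Feasible (flip₂ f u l) × Feasible (flip₂ g u l))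

  module Step {f g : Vector Bool n}
    (smaller : ∀ {f′ g′} → dist f′ g′ < dist f g → Feasible f′ → Feasible g′ →
               ∀ {u} → f′ u ≢ g′ u → Simultaneous f′ g′ u)
    (Ff : Feasible f) (Fg : Feasible g)
    where

    module FourPoints {u t r w : Fin n}
      (t≢u : t ≢ u) (r≢u : r ≢ u) (w≢u : w ≢ u) (r≢t : r ≢ t) (w≢t : w ≢ t) (w≢r : w ≢ r)
      (fu≢gu : f u ≢ g u) (ft≢gt : f t ≢ g t) (fr≢gr : f r ≢ g r) (fw≢gw : f w ≢ g w)
      (Fgut : Feasible (flip₂ g u t)) (Fguw : Feasible (flip₂ g u w))
      (Fh : Feasible (flip₂ (flip₂ f t r) u w))
      where

      h : Vector Bool n
      h = flip₂ (flip₂ f t r) u w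

      Among : Fin n → Set
      Among i = i ≡ w ⊎ i ≡ u ⊎ i ≡ r ⊎ i ≡ t

      among? : ∀ i → Dec (Among i)
      among? i = (i ≟ w) ⊎-dec (i ≟ u) ⊎-dec (i ≟ r) ⊎-dec (i ≟ t)

      h-flips : ∀ {i} → Among i → f i ≢ h i
      h-flips {i} i∈ fi≡hi = not-¬ refl (trans fi≡hi (flipped i∈))
        where
        flipped : Among i → h i ≡ not (f i)
        flipped (inj₁ refl) = trans (flip₂-atʳ (flip₂ f t r) (≢-sym w≢u)) (cong not (flip₂-off f w≢t w≢r))
        flipped (inj₂ (inj₁ refl)) =
          trans (flip₂-atˡ (flip₂ f t r) (≢-sym w≢u)) (cong not (flip₂-off f (≢-sym t≢u) (≢-sym r≢u)))
        flipped (inj₂ (inj₂ (inj₁ refl))) = trans (flip₂-off (flip₂ f t r) r≢u (≢-sym w≢r)) (flip₂-atʳ f (≢-sym r≢t))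
        flipped (inj₂ (inj₂ (inj₂ refl))) = trans (flip₂-off (flip₂ f t r) t≢u (≢-sym w≢t)) (flip₂-atˡ f (≢-sym r≢t))

      h-differs⇒g-differs : ∀ i → f i ≢ h i → f i ≢ g i
      h-differs⇒g-differs i differ with flip₂²-support f (≢-sym differ)
      ... | inj₁ refl = fw≢gw
      ... | inj₂ (inj₁ refl) = fu≢gu
      ... | inj₂ (inj₂ (inj₁ refl)) = fr≢gr
      ... | inj₂ (inj₂ (inj₂ refl)) = ft≢gt

      module _ {i : Fin n} where
        open xor-∧-Solver

        h-flip₂-ur : flip₂ h u r i ≡ flip₂ f t w i
        h-flip₂-ur = solve 5 (λ T R U W s → R :+ (U :+ (W :+ (U :+ (R :+ (T :+ s))))) := W :+ (T :+ s)) refl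
                       ⌊ i ≟ t ⌋ ⌊ i ≟ r ⌋ ⌊ i ≟ u ⌋ ⌊ i ≟ w ⌋ (f i)

        h-flip₂-rw : flip₂ h r w i ≡ flip₂ f u t i
        h-flip₂-rw = solve 5 (λ T R U W s → W :+ (R :+ (W :+ (U :+ (R :+ (T :+ s))))) := T :+ (U :+ s)) refl
                       ⌊ i ≟ t ⌋ ⌊ i ≟ r ⌋ ⌊ i ≟ u ⌋ ⌊ i ≟ w ⌋ (f i)

        h-flip₂-rt : flip₂ h r t i ≡ flip₂ f u w i
        h-flip₂-rt = solve 5 (λ T R U W s → T :+ (R :+ (W :+ (U :+ (R :+ (T :+ s))))) := W :+ (U :+ s)) refl
                       ⌊ i ≟ t ⌋ ⌊ i ≟ r ⌋ ⌊ i ≟ u ⌋ ⌊ i ≟ w ⌋ (f i)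

      g≗h : (∀ {i} → f i ≢ g i → Among i) → g ≗ h
      g≗h among = differ-alike (λ i d → h-flips (among d)) h-differs⇒g-differs

      only-four-differences : (∀ {i} → f i ≢ g i → Among i) → Simultaneous f g u
      only-four-differences among with exchange Ff Fg fu≢gu
      ... | l , l≢u , fl≢gl , Fful with among fl≢gl
      ...   | inj₁ refl = w , w≢u , fw≢gw , Fful , Fguw
      ...   | inj₂ (inj₁ refl) = ⊥-elim (l≢u refl)
      ...   | inj₂ (inj₂ (inj₂ refl)) = t , t≢u , ft≢gt , Fful , Fgut
      ...   | inj₂ (inj₂ (inj₁ refl)) with exchange Fg Ff (≢-sym fr≢gr)
      ...     | v , v≢r , gv≢fv , Fgrv with among (≢-sym gv≢fv)
      ...       | inj₁ refl = t , t≢u , ft≢gt ,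
        feasible-resp (λ i → trans (flip-cong w (flip-cong r (g≗h among)) i) (h-flip₂-rw {i})) Fgrv , Fgut
      ...       | inj₂ (inj₁ refl) = r , r≢u , fr≢gr , Fful , feasible-resp (flip₂-comm g r u) Fgrv
      ...       | inj₂ (inj₂ (inj₁ refl)) = ⊥-elim (v≢r refl)
      ...       | inj₂ (inj₂ (inj₂ refl)) = w , w≢u , fw≢gw ,
        feasible-resp (λ i → trans (flip-cong t (flip-cong r (g≗h among)) i) (h-flip₂-rt {i})) Fgrv , Fguw

      h-agrees : ∀ {i} → ¬ Among i → f i ≡ h i
      h-agrees {i} i∉ with f i Boolₚ.≟ h i
      ... | yes fi≡hi = fi≡hi
      ... | no fi≢hi = ⊥-elim (i∉ (flip₂²-support f (≢-sym fi≢hi)))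

      -- Exchanging f towards f △ {t, w, u, w′} at u lands on t, w or w′, and g △ {u, ·} is feasible for all three.
      via-flip-tw : Feasible (flip₂ f t w) → Simultaneous f g u
      via-flip-tw Fftw with smaller (dist-flip₂-< (≢-sym w≢t) ft≢gt fw≢gw) Fftw Fg
                      (λ e → fu≢gu (trans (sym (flip₂-off f (≢-sym t≢u) (≢-sym w≢u))) e))
      ... | w′ , w′≢u , f₂w′≢gw′ , Ff₂uw′ , Fguw′ with flip₂-remaining (≢-sym w≢t) ft≢gt fw≢gw f₂w′≢gw′
      ...   | w′≢t , w′≢w , fw′≢gw′
        with exchange Ff Ff₂uw′ (flip₂²-flips f (≢-sym t≢u) (≢-sym w≢u) (≢-sym w′≢u))
      ...     | l , l≢u , fl≢h′l , Fful with flip₂²-support f (≢-sym fl≢h′l)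
      ...       | inj₁ refl = w′ , w′≢u , fw′≢gw′ , Fful , Fguw′
      ...       | inj₂ (inj₁ refl) = ⊥-elim (l≢u refl)
      ...       | inj₂ (inj₂ (inj₁ refl)) = w , w≢u , fw≢gw , Fful , Fguw
      ...       | inj₂ (inj₂ (inj₂ refl)) = t , t≢u , ft≢gt , Fful , Fgut

      -- The induction hypothesis for f and h lands on w, r or t, and h △ {u, r} = f △ {t, w}.
      fifth-difference : ∀ {z} → f z ≢ g z → ¬ Among z → Simultaneous f g u
      fifth-difference {z} fz≢gz z∉
        with smaller (dist-< h-differs⇒g-differs z (h-agrees z∉) fz≢gz) Ff Fh (h-flips (inj₂ (inj₁ refl)))
      ... | l , l≢u , fl≢hl , Fful , Fhul with flip₂²-support f (≢-sym fl≢hl)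
      ...   | inj₁ refl = w , w≢u , fw≢gw , Fful , Fguw
      ...   | inj₂ (inj₁ refl) = ⊥-elim (l≢u refl)
      ...   | inj₂ (inj₂ (inj₁ refl)) = via-flip-tw (feasible-resp (λ i → h-flip₂-ur {i}) Fhul)
      ...   | inj₂ (inj₂ (inj₂ refl)) = t , t≢u , ft≢gt , Fful , Fgut

      -- If f and g differ only on {t, r, u, w} then g = h; otherwise h is closer to f than g is.
      simultaneous : Simultaneous f g u
      simultaneous with Finₚ.any? (λ z → ¬? (f z Boolₚ.≟ g z) ×-dec ¬? (among? z))
      ... | yes (z , fz≢gz , z∉) = fifth-difference fz≢gz z∉
      ... | no none = only-four-differences λ {i} fi≢gi → decidable-stable (among? i) (λ i∉ → none (i , fi≢gi , i∉))

    step : ∀ {u} → f u ≢ g u → Simultaneous f g u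
    step {u} fu≢gu with exchange Fg Ff (≢-sym fu≢gu)
    ... | t , t≢u , gt≢ft , Fgut with exchange Ff Fg (≢-sym gt≢ft)
    ... | r , r≢t , fr≢gr , Fftr with r ≟ u
    ... | yes refl = t , t≢u , ≢-sym gt≢ft , feasible-resp (flip₂-comm f t r) Fftr , Fgut
    ... | no r≢u with smaller (dist-flip₂-< (≢-sym r≢t) (≢-sym gt≢ft) fr≢gr) Fftr Fg
                         (λ e → fu≢gu (trans (sym (flip₂-off f (≢-sym t≢u) (≢-sym r≢u))) e))
    ... | w , w≢u , f₁w≢gw , Ff₁uw , Fguw with flip₂-remaining (≢-sym r≢t) (≢-sym gt≢ft) fr≢gr f₁w≢gw
    ... | w≢t , w≢r , fw≢gw =
      FourPoints.simultaneous t≢u r≢u w≢u r≢t w≢t w≢r fu≢gu (≢-sym gt≢ft) fr≢gr fw≢gw Fgut Fguw Ff₁uw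

  -- Abstract: unfolding the well-founded recursion where the result is scrutinised exhausts memory.
  abstract
    simultaneous-exchange : ∀ {f g} → Feasible f → Feasible g → ∀ {u} → f u ≢ g u → Simultaneous f g u
    simultaneous-exchange {f} {g} = <-rec Goal go (dist f g) refl
      where
      Goal : ℕ → Set
      Goal d = ∀ {f g} → dist f g ≡ d → Feasible f → Feasible g → ∀ {u} → f u ≢ g u → Simultaneous f g u
      go : ∀ d → (∀ {d′} → d′ < d → Goal d′) → Goal d
      go _ rec refl = Step.step (λ lt → rec lt refl)

mem-build : (f : E n → Bool) (x : E n) → mem (build f) x ≡ f x
mem-build f (i , false) = lookup∘tabulate _ i
mem-build f (i , true) = lookup∘tabulate _ i

sub-ext : {S T : Sub n} → (∀ x → mem S x ≡ mem T x) → S ≡ T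
sub-ext h = cong₂ _,_ (Pointwise-≡⇒≡ (ext λ i → h (i , false))) (Pointwise-≡⇒≡ (ext λ i → h (i , true)))

build-cong : {F G : E n → Bool} → (∀ x → F x ≡ G x) → build F ≡ build G
build-cong {F = F} {G} h = sub-ext λ x → trans (mem-build F x) (trans (h x) (sym (mem-build G x)))

mem-∪ : (S T : Sub n) (x : E n) → mem (S ∪ₛ T) x ≡ mem S x ∨ mem T x
mem-∪ S T = mem-build (λ y → mem S y ∨ mem T y)

mem-∖ : (S T : Sub n) (x : E n) → mem (S ∖ₛ T) x ≡ mem S x ∧ not (mem T x)
mem-∖ S T = mem-build (λ y → mem S y ∧ not (mem T y))

mem-∪⁅⁆ : (S : Sub n) (e x : E n) → mem (S ∪ₛ ⁅ e ⁆ₛ) x ≡ mem S x ∨ (x == e)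
mem-∪⁅⁆ S e x = trans (mem-∪ S ⁅ e ⁆ₛ x) (cong (mem S x ∨_) (mem-build (_== e) x))

mem-∖⁅⁆ : (S : Sub n) (e x : E n) → mem (S ∖ₛ ⁅ e ⁆ₛ) x ≡ mem S x ∧ not (x == e)
mem-∖⁅⁆ S e x = trans (mem-∖ S ⁅ e ⁆ₛ x) (cong (λ b → mem S x ∧ not b) (mem-build (_== e) x))

build-∖∪ : {F G : E n → Bool} {e f : E n} → (∀ x → (F x ∧ not (x == e)) ∨ (x == f) ≡ G x) →
           (build F ∖ₛ ⁅ e ⁆ₛ) ∪ₛ ⁅ f ⁆ₛ ≡ build G
build-∖∪ {F = F} {G} {e} {f} h = sub-ext λ x → begin
  mem ((build F ∖ₛ ⁅ e ⁆ₛ) ∪ₛ ⁅ f ⁆ₛ) x        ≡⟨ mem-∪⁅⁆ _ f x ⟩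
  mem (build F ∖ₛ ⁅ e ⁆ₛ) x ∨ (x == f)         ≡⟨ cong (_∨ (x == f)) (mem-∖⁅⁆ _ e x) ⟩
  (mem (build F) x ∧ not (x == e)) ∨ (x == f)  ≡⟨ cong (λ b → (b ∧ not (x == e)) ∨ (x == f)) (mem-build F x) ⟩
  (F x ∧ not (x == e)) ∨ (x == f)              ≡⟨ h x ⟩
  G x                                          ≡⟨ mem-build G x ⟨
  mem (build G) x                              ∎
  where open ≡-Reasoning

==-refl : (x : E n) → (x == x) ≡ true
==-refl (i , b) rewrite ⌊⌋-yes (i ≟ i) refl | ⌊⌋-yes (b Boolₚ.≟ b) refl = refl

==-sound : {x y : E n} → (x == y) ≡ true → x ≡ y
==-sound {x = i , b} {j , c} h with i ≟ j | b Boolₚ.≟ c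
==-sound h | yes refl | yes refl = refl
==-sound () | no _ | _
==-sound () | yes _ | no _

∪∖-comm : {e f : E n} → e ≢ f → (S : Sub n) → (S ∪ₛ ⁅ e ⁆ₛ) ∖ₛ ⁅ f ⁆ₛ ≡ (S ∖ₛ ⁅ f ⁆ₛ) ∪ₛ ⁅ e ⁆ₛ
∪∖-comm {e = e} {f} e≢f S = sub-ext λ x → begin
  mem ((S ∪ₛ ⁅ e ⁆ₛ) ∖ₛ ⁅ f ⁆ₛ) x      ≡⟨ trans (mem-∖⁅⁆ _ f x) (cong (_∧ not (x == f)) (mem-∪⁅⁆ S e x)) ⟩
  (mem S x ∨ (x == e)) ∧ not (x == f)  ≡⟨ commute (mem S x) (x == e) (x == f)
                                             (λ x≡e x≡f → trans (sym (==-sound {x = x} x≡e)) (==-sound x≡f)) ⟩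
  (mem S x ∧ not (x == f)) ∨ (x == e)  ≡⟨ trans (mem-∪⁅⁆ _ e x) (cong (_∨ (x == e)) (mem-∖⁅⁆ S f x)) ⟨
  mem ((S ∖ₛ ⁅ f ⁆ₛ) ∪ₛ ⁅ e ⁆ₛ) x      ∎
  where
  open ≡-Reasoning
  commute : ∀ a c d → (c ≡ true → d ≡ true → e ≡ f) → (a ∨ c) ∧ not d ≡ (a ∧ not d) ∨ c
  commute a true true c⇒d = ⊥-elim (e≢f (c⇒d refl refl))
  commute true true false _ = refl
  commute false true false _ = refl
  commute true false d _ = sym (∨-identityʳ _)
  commute false false d _ = refl

∖⁅⁆-⊆ : ∀ (S : Sub n) e x → x ∈ₛ (S ∖ₛ ⁅ e ⁆ₛ) → x ∈ₛ S
∖⁅⁆-⊆ S e x h = ∧-trueˡ (trans (sym (mem-∖⁅⁆ S e x)) h)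

∖⁅⁆-∌ : ∀ (S : Sub n) e → e ∉ₛ (S ∖ₛ ⁅ e ⁆ₛ)
∖⁅⁆-∌ S e = trans (mem-∖⁅⁆ S e e) (trans (cong (λ b → mem S e ∧ not b) (==-refl e)) (∧-zeroʳ _))

∪⁅⁆-∋ : ∀ (S : Sub n) e → e ∈ₛ (S ∪ₛ ⁅ e ⁆ₛ)
∪⁅⁆-∋ S e = trans (mem-∪⁅⁆ S e e) (trans (cong (mem S e ∨_) (==-refl e)) (∨-zeroʳ _))

∪⁅⁆-⊇ : ∀ (S : Sub n) e x → x ∈ₛ S → x ∈ₛ (S ∪ₛ ⁅ e ⁆ₛ)
∪⁅⁆-⊇ S e x h = trans (mem-∪⁅⁆ S e x) (cong (_∨ (x == e)) h)

∪⁅⁆-other : ∀ (S : Sub n) {k m : Fin n} c b → m ≢ k → mem (S ∪ₛ ⁅ k , c ⁆ₛ) (m , b) ≡ mem S (m , b)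
∪⁅⁆-other S {k} {m} c b m≢k = trans (mem-∪⁅⁆ S (k , c) (m , b))
  (trans (cong (λ z → mem S (m , b) ∨ (z ∧ ⌊ b Boolₚ.≟ c ⌋)) (⌊⌋-no (m ≟ k) m≢k)) (∨-identityʳ _))

∪𝓕-introˡ : ∀ (𝓐 𝓒 : Family n) {X} → X ∈𝓕 𝓐 → X ∈𝓕 (𝓐 ∪𝓕 𝓒)
∪𝓕-introˡ 𝓐 𝓒 {X} X∈𝓐 = cong (_∨ 𝓒 X) X∈𝓐

∪𝓕-introʳ : ∀ (𝓐 𝓒 : Family n) {X} → X ∈𝓕 𝓒 → X ∈𝓕 (𝓐 ∪𝓕 𝓒)
∪𝓕-introʳ 𝓐 𝓒 {X} X∈𝓒 = trans (cong (𝓐 X ∨_) X∈𝓒) (∨-zeroʳ _)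

∪𝓕-elim : ∀ (𝓐 𝓒 : Family n) X → X ∈𝓕 (𝓐 ∪𝓕 𝓒) → X ∈𝓕 𝓐 ⊎ X ∈𝓕 𝓒
∪𝓕-elim 𝓐 𝓒 X X∈ with 𝓐 X
... | true = inj₁ refl
... | false = inj₂ X∈

_≟ₛ_ : (S T : Sub n) → Dec (S ≡ T)
_≟ₛ_ = ×ₚ.≡-dec (Vecₚ.≡-dec Boolₚ._≟_) (Vecₚ.≡-dec Boolₚ._≟_)

starred : Sub n → Vector Bool n
starred S i = mem S (i , true)

HasHoleAt : Sub n → Fin n → Set
HasHoleAt S i = ((i , false) ∉ₛ S) × ((i , true) ∉ₛ S)

skew-side : ∀ {S : Sub n} {i} → HasSkewAt S i → ∀ b → (i , b) ∈ₛ S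
skew-side (in₁ , _) false = in₁
skew-side (_ , in₂) true = in₂

hole-side : ∀ {S : Sub n} {i} → HasHoleAt S i → ∀ b → (i , b) ∉ₛ S
hole-side (out₁ , _) false = out₁
hole-side (_ , out₂) true = out₂

skew-∖ : ∀ (S : Sub n) e {i} → HasSkewAt (S ∖ₛ ⁅ e ⁆ₛ) i → HasSkewAt S i
skew-∖ S e {i} (in₁ , in₂) = ∖⁅⁆-⊆ S e (i , false) in₁ , ∖⁅⁆-⊆ S e (i , true) in₂

skew-∪ : ∀ (S : Sub n) e {i} → HasSkewAt S i → HasSkewAt (S ∪ₛ ⁅ e ⁆ₛ) i
skew-∪ S e {i} (in₁ , in₂) = ∪⁅⁆-⊇ S e (i , false) in₁ , ∪⁅⁆-⊇ S e (i , true) in₂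

skew-∪-other : ∀ (S : Sub n) {k i} c → i ≢ k → HasSkewAt (S ∪ₛ ⁅ k , c ⁆ₛ) i → HasSkewAt S i
skew-∪-other S c i≢k (in₁ , in₂) =
  trans (sym (∪⁅⁆-other S c false i≢k)) in₁ , trans (sym (∪⁅⁆-other S c true i≢k)) in₂

skew-from : ∀ (S : Sub n) {k} c → (k , c) ∈ₛ S → (k , not c) ∈ₛ S → HasSkewAt S k
skew-from S false in₁ in₂ = in₁ , in₂
skew-from S true in₁ in₂ = in₂ , in₁

countV-sum : ∀ {m} (v : Vec Bool m) → countV v ≡ sum (λ i → bit (lookup v i))
countV-sum [] = refl
countV-sum (true ∷ v) = cong suc (countV-sum v)
countV-sum (false ∷ v) = countV-sum v

pairCount : Sub n → Vector ℕ n
pairCount S i = bit (mem S (i , false)) + bit (mem S (i , true))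

size-sum : (S : Sub n) → size S ≡ sum (pairCount S)
size-sum (v , w) = trans (cong₂ _+_ (countV-sum v) (countV-sum w)) (sym (sum-+ (bit ∘ lookup v) (bit ∘ lookup w)))

pairCount≤2 : (S : Sub n) (i : Fin n) → pairCount S i ≤ 2
pairCount≤2 S i with mem S (i , false) | mem S (i , true)
... | true | true = ℕₚ.≤-refl
... | true | false = s≤s z≤n
... | false | true = s≤s z≤n
... | false | false = z≤n

noSkew⇒pairCount≤1 : (S : Sub n) (i : Fin n) → ¬ HasSkewAt S i → pairCount S i ≤ 1
noSkew⇒pairCount≤1 S i ¬skew with mem S (i , false) | mem S (i , true)
... | true | true = ⊥-elim (¬skew (refl , refl))
... | true | false = ℕₚ.≤-refl
... | false | true = ℕₚ.≤-refl
... | false | false = z≤n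

noHole⇒1≤pairCount : (S : Sub n) (i : Fin n) → ¬ HasHoleAt S i → 1 ≤ pairCount S i
noHole⇒1≤pairCount S i ¬hole with mem S (i , false) | mem S (i , true)
... | true | _ = s≤s z≤n
... | false | true = s≤s z≤n
... | false | false = ⊥-elim (¬hole (refl , refl))

skew⇒pairCount≡2 : (S : Sub n) (i : Fin n) → HasSkewAt S i → pairCount S i ≡ 2
skew⇒pairCount≡2 S i (in₁ , in₂) rewrite in₁ | in₂ = refl

hole⇒pairCount≡0 : (S : Sub n) (i : Fin n) → HasHoleAt S i → pairCount S i ≡ 0
hole⇒pairCount≡0 S i (out₁ , out₂) rewrite out₁ | out₂ = refl

noSkew-noHole⇒one-side : (S : Sub n) (i : Fin n) → ¬ HasSkewAt S i → ¬ HasHoleAt S i →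
                         ∀ b → mem S (i , b) ≡ ⌊ b Boolₚ.≟ starred S i ⌋
noSkew-noHole⇒one-side S i ¬skew ¬hole true = sym (⌊true≟⌋ _)
noSkew-noHole⇒one-side S i ¬skew ¬hole false = trans unstarred (sym (⌊false≟⌋ _))
  where
  unstarred : mem S (i , false) ≡ not (mem S (i , true))
  unstarred with mem S (i , false) | mem S (i , true)
  ... | true | true = ⊥-elim (¬skew (refl , refl))
  ... | true | false = refl
  ... | false | true = refl
  ... | false | false = ⊥-elim (¬hole (refl , refl))

Exchange : Family n → Sub n → Sub n → E n → Set
Exchange 𝓐 B B′ e = ∃[ f ] (f ∈ₛ B′ × f ∉ₛ B × ((B ∖ₛ ⁅ e ⁆ₛ) ∪ₛ ⁅ f ⁆ₛ) ∈𝓕 𝓐 × ((B′ ∪ₛ ⁅ e ⁆ₛ) ∖ₛ ⁅ f ⁆ₛ) ∈𝓕 𝓐)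

-- Transversals and almost-transversals

inTr : Vector Bool n → E n → Bool
inTr σ (m , b) = ⌊ b Boolₚ.≟ σ m ⌋

tr : Vector Bool n → Sub n
tr σ = build (inTr σ)

-- (T ∪ {p, p*}) ∖ {q, q*} for the transversal T = tr α.
inAlm : Vector Bool n → Fin n → Fin n → E n → Bool
inAlm α p q (m , b) = if ⌊ m ≟ p ⌋ then true else if ⌊ m ≟ q ⌋ then false else ⌊ b Boolₚ.≟ α m ⌋

alm : Vector Bool n → Fin n → Fin n → Sub n
alm α p q = build (inAlm α p q)

mem-tr : ∀ σ (m : Fin n) b → mem (tr σ) (m , b) ≡ ⌊ b Boolₚ.≟ σ m ⌋
mem-tr σ m b = mem-build (inTr σ) (m , b)

tr-∈ : ∀ σ {m : Fin n} {b} → (m , b) ∈ₛ tr σ → b ≡ σ m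
tr-∈ σ {m} {b} h = ⌊⌋-sound (b Boolₚ.≟ σ m) (trans (sym (mem-tr σ m b)) h)

tr-self : ∀ σ (m : Fin n) → (m , σ m) ∈ₛ tr σ
tr-self σ m = trans (mem-tr σ m (σ m)) (⌊⌋-yes (σ m Boolₚ.≟ σ m) refl)

tr-∉ : ∀ σ {m : Fin n} {b} → (m , b) ∉ₛ tr σ → b ≢ σ m
tr-∉ σ {m} h refl = true≢false (trans (sym (tr-self σ m)) h)

tr-other : ∀ σ {m : Fin n} {b} → b ≢ σ m → (m , b) ∉ₛ tr σ
tr-other σ {m} {b} b≢σm = trans (mem-tr σ m b) (⌊⌋-no (b Boolₚ.≟ σ m) b≢σm)

tr-cong : ∀ {σ τ : Vector Bool n} → σ ≗ τ → tr σ ≡ tr τ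
tr-cong σ≗τ = build-cong λ (m , b) → cong (λ s → ⌊ b Boolₚ.≟ s ⌋) (σ≗τ m)

tr-noSkew : ∀ σ → NoSkewPair {n} (tr σ)
tr-noSkew σ i (in₁ , in₂) = true≢false (trans (tr-∈ σ in₂) (sym (tr-∈ σ in₁)))

tr-noHole : ∀ σ (i : Fin n) → ¬ HasHoleAt (tr σ) i
tr-noHole σ i (out₁ , out₂) with σ i in σi
... | true = tr-∉ σ out₂ (sym σi)
... | false = tr-∉ σ out₁ (sym σi)

pairCount-tr : ∀ σ (i : Fin n) → pairCount (tr σ) i ≡ 1
pairCount-tr σ i = ℕₚ.≤-antisym (noSkew⇒pairCount≤1 (tr σ) i (tr-noSkew σ i))
                                (noHole⇒1≤pairCount (tr σ) i (tr-noHole σ i))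

tr-transversal : ∀ σ → Transversal {n} (tr σ)
tr-transversal {n} σ = trans (size-sum (tr σ)) (trans (sum-cong-≗ (pairCount-tr σ)) (sum-1 n)) , tr-noSkew σ

size≡n-noSkew⇒noHole : (S : Sub n) → size S ≡ n → NoSkewPair S → ∀ i → ¬ HasHoleAt S i
size≡n-noSkew⇒noHole {n} S size≡n noSkew i hole = ℕₚ.<⇒≢ size<n size≡n
  where
  size<n : size S < n
  size<n = subst₂ _<_ (sym (size-sum S)) (sum-1 n)
    (sum-mono-< (λ j → noSkew⇒pairCount≤1 S j (noSkew j)) i (subst (_< 1) (sym (hole⇒pairCount≡0 S i hole)) (s≤s z≤n)))

size≡n-skew⇒hole : (S : Sub n) {p : Fin n} → size S ≡ n → HasSkewAt S p → ∃[ q ] HasHoleAt S q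
size≡n-skew⇒hole {n} S {p} size≡n skew
  with Finₚ.any? (λ q → (mem S (q , false) Boolₚ.≟ false) ×-dec (mem S (q , true) Boolₚ.≟ false))
... | yes hole = hole
... | no noHole = ⊥-elim (ℕₚ.<⇒≢ n<size (sym size≡n))
  where
  n<size : n < size S
  n<size = subst₂ _<_ (sum-1 n) (sym (size-sum S))
    (sum-mono-< (λ j → noHole⇒1≤pairCount S j (λ hole → noHole (j , hole))) p
                (subst (1 <_) (sym (skew⇒pairCount≡2 S p skew)) ℕₚ.≤-refl))

transversal⇒tr : {S : Sub n} → Transversal S → S ≡ tr (starred S)
transversal⇒tr {n} {S} (size≡n , noSkew) = sub-ext λ (i , b) →
  trans (noSkew-noHole⇒one-side S i (noSkew i) (size≡n-noSkew⇒noHole S size≡n noSkew i) b) (sym (mem-tr _ i b))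

mem-alm : ∀ α (p q : Fin n) x → mem (alm α p q) x ≡ inAlm α p q x
mem-alm α p q x = mem-build (inAlm α p q) x

alm-p : ∀ α (p q : Fin n) b → (p , b) ∈ₛ alm α p q
alm-p α p q b rewrite mem-alm α p q (p , b) | ⌊⌋-yes (p ≟ p) refl = refl

alm-q : ∀ α {p q : Fin n} → p ≢ q → ∀ b → (q , b) ∉ₛ alm α p q
alm-q α {p} {q} p≢q b rewrite mem-alm α p q (q , b) | ⌊⌋-no (q ≟ p) (≢-sym p≢q) | ⌊⌋-yes (q ≟ q) refl = refl

alm-skew : ∀ α (p q : Fin n) → HasSkewAt (alm α p q) p
alm-skew α p q = alm-p α p q false , alm-p α p q true

alm-hole : ∀ α {p q : Fin n} → p ≢ q → HasHoleAt (alm α p q) q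
alm-hole α p≢q = alm-q α p≢q false , alm-q α p≢q true

alm-other : ∀ α {p q m : Fin n} → m ≢ p → m ≢ q → ∀ b → mem (alm α p q) (m , b) ≡ mem (tr α) (m , b)
alm-other α {p} {q} {m} m≢p m≢q b
  rewrite mem-alm α p q (m , b) | ⌊⌋-no (m ≟ p) m≢p | ⌊⌋-no (m ≟ q) m≢q = sym (mem-tr α m b)

alm-cong : ∀ {α β} {p q : Fin n} → (∀ m → m ≢ p → m ≢ q → α m ≡ β m) → alm α p q ≡ alm β p q
alm-cong {α = α} {β} {p} {q} α≡β = build-cong same
  where
  same : ∀ x → inAlm α p q x ≡ inAlm β p q x
  same (m , b) with m ≟ p | m ≟ q
  ... | yes _ | _ = refl
  ... | no _ | yes _ = refl
  ... | no m≢p | no m≢q = cong (λ s → ⌊ b Boolₚ.≟ s ⌋) (α≡β m m≢p m≢q)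

alm-flip₂ : ∀ α (p q : Fin n) → alm (flip₂ α p q) p q ≡ alm α p q
alm-flip₂ α p q = alm-cong (λ m m≢p m≢q → flip₂-off α m≢p m≢q)

alm-reset : ∀ σ {p q : Fin n} b c → alm (reset σ p q b c) p q ≡ alm σ p q
alm-reset σ b c = alm-cong (λ m m≢p m≢q → reset-off σ b c m≢p m≢q)

starred-alm : ∀ α {p q m : Fin n} → m ≢ p → m ≢ q → starred (alm α p q) m ≡ α m
starred-alm α {m = m} m≢p m≢q = trans (alm-other α m≢p m≢q true) (trans (mem-tr α m true) (⌊true≟⌋ (α m)))

pairCount-alm-other : ∀ α {p q m : Fin n} → m ≢ p → m ≢ q → pairCount (alm α p q) m ≡ 1
pairCount-alm-other α {m = m} m≢p m≢q =
  trans (cong₂ (λ x y → bit x + bit y) (alm-other α m≢p m≢q false) (alm-other α m≢p m≢q true)) (pairCount-tr α m)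

alm-∋ : ∀ α {p q l : Fin n} → l ≢ q → (l , α l) ∈ₛ alm α p q
alm-∋ α {p} {q} {l} l≢q with l ≟ p
... | yes refl = alm-p α l q (α l)
... | no l≢p = trans (alm-other α l≢p l≢q (α l)) (tr-self α l)

alm-∌ : ∀ α {p q l : Fin n} {c} → p ≢ q → l ≢ p → c ≢ α l → (l , c) ∉ₛ alm α p q
alm-∌ α {p} {q} {l} {c} p≢q l≢p c≢αl with l ≟ q
... | yes refl = alm-q α p≢q c
... | no l≢q = trans (alm-other α l≢p l≢q c) (tr-other α c≢αl)

alm-swap-difference : ∀ ρ {p q l : Fin n} {d} → p ≢ q → (l , d) ∈ₛ alm ρ q p → (l , d) ∉ₛ alm ρ p q → l ≡ q
alm-swap-difference ρ {p} {q} {l} {d} p≢q l∈ l∉ with l ≟ q | l ≟ p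
... | yes l≡q | _ = l≡q
... | no _ | yes refl = ⊥-elim (true≢false (trans (sym l∈) (alm-q ρ (≢-sym p≢q) d)))
... | no l≢q | no l≢p =
  ⊥-elim (true≢false (trans (sym l∈) (trans (alm-other ρ l≢q l≢p d) (trans (sym (alm-other ρ l≢p l≢q d)) l∉))))

alm-skew⇒ : ∀ α {p q i : Fin n} → HasSkewAt (alm α p q) i → i ≡ p
alm-skew⇒ α {p} {q} {i} (in₁ , in₂) with i ≟ p | i ≟ q
... | yes i≡p | _ = i≡p
... | no i≢p | yes refl = ⊥-elim (true≢false (trans (sym in₁) (alm-q α (≢-sym i≢p) false)))
... | no i≢p | no i≢q = ⊥-elim (tr-noSkew α i (trans (sym (alm-other α i≢p i≢q false)) in₁ ,
                                               trans (sym (alm-other α i≢p i≢q true)) in₂))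

alm-hole⇒ : ∀ α {p q i : Fin n} → HasHoleAt (alm α p q) i → i ≡ q
alm-hole⇒ α {p} {q} {i} (out₁ , out₂) with i ≟ p | i ≟ q
... | yes refl | _ = ⊥-elim (true≢false (trans (sym (alm-p α i q false)) out₁))
... | no _ | yes i≡q = i≡q
... | no i≢p | no i≢q = ⊥-elim (tr-noHole α i (trans (sym (alm-other α i≢p i≢q false)) out₁ ,
                                               trans (sym (alm-other α i≢p i≢q true)) out₂))

alm-injective : ∀ {τ α} {i j p q : Fin n} → i ≢ j → alm τ i j ≡ alm α p q →
                i ≡ p × j ≡ q × (∀ m → m ≢ i → m ≢ j → τ m ≡ α m)
alm-injective {τ = τ} {α} {i} {j} {p} {q} i≢j eq with alm-skew⇒ α (subst (λ S → HasSkewAt S i) eq (alm-skew τ i j))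
... | refl with alm-hole⇒ α (subst (λ S → HasHoleAt S j) eq (alm-hole τ i≢j))
... | refl = refl , refl , λ m m≢i m≢j →
  trans (sym (starred-alm τ m≢i m≢j)) (trans (cong (λ S → starred S m) eq) (starred-alm α m≢i m≢j))

alm-size : ∀ α {p q : Fin n} → p ≢ q → size (alm α p q) ≡ n
alm-size {n} α {p} {q} p≢q = trans (size-sum A) (ℕₚ.+-cancelʳ-≡ 2 _ _ (begin
  sum (pairCount A) + 2           ≡⟨ ℕₚ.+-assoc (sum (pairCount A)) 1 1 ⟨
  sum (pairCount A) + 1 + 1       ≡⟨ cong (λ k → sum (pairCount A) + k + 1) (filled≡1 q (≢-sym p≢q)) ⟨
  sum (pairCount A) + filled q + 1 ≡⟨ cong (_+ 1) (sum-differ-at q A≡filled) ⟩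
  sum filled + pairCount A q + 1  ≡⟨ cong (λ k → sum filled + k + 1) (hole⇒pairCount≡0 A q (alm-hole α p≢q)) ⟩
  sum filled + 0 + 1              ≡⟨ cong (_+ 1) (ℕₚ.+-identityʳ (sum filled)) ⟩
  sum filled + 1                  ≡⟨ sum-differ-at p filled≡1 ⟩
  sum {n} (λ _ → 1) + filled p    ≡⟨ cong₂ _+_ (sum-1 n) (cong (λ d → if d then 2 else 1) (⌊⌋-yes (p ≟ p) refl)) ⟩
  n + 2                           ∎))
  where
  open ≡-Reasoning
  A : Sub n
  A = alm α p q
  filled : Vector ℕ n
  filled m = if ⌊ m ≟ p ⌋ then 2 else 1
  filled≡1 : ∀ m → m ≢ p → filled m ≡ 1
  filled≡1 m m≢p rewrite ⌊⌋-no (m ≟ p) m≢p = refl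
  A≡filled : ∀ m → m ≢ q → pairCount A m ≡ filled m
  A≡filled m m≢q with m ≟ p
  ... | yes refl = skew⇒pairCount≡2 A m (alm-skew α m q)
  ... | no m≢p = pairCount-alm-other α m≢p m≢q

alm-almostTransversal : ∀ α {p q : Fin n} → p ≢ q → AlmostTransversal (alm α p q)
alm-almostTransversal α {p} {q} p≢q = alm-size α p≢q , p , alm-skew α p q , λ _ → alm-skew⇒ α

size≡n-oneSkew⇒noOtherHole : (S : Sub n) {p q m : Fin n} → size S ≡ n → (∀ j → HasSkewAt S j → j ≡ p) →
                             HasHoleAt S q → p ≢ q → m ≢ p → m ≢ q → ¬ HasHoleAt S m
size≡n-oneSkew⇒noOtherHole {n} S {p} {q} {m} size≡n skew⇒p hole p≢q m≢p m≢q hole-m = ℕₚ.<⇒≢ size<n size≡n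
  where
  A : Sub n
  A = alm (starred S) p q
  S≤A : ∀ j → pairCount S j ≤ pairCount A j
  S≤A j with j ≟ p | j ≟ q
  ... | yes refl | _ = subst (pairCount S j ≤_) (sym (skew⇒pairCount≡2 A j (alm-skew _ j q))) (pairCount≤2 S j)
  ... | no _ | yes refl = subst (_≤ pairCount A j) (sym (hole⇒pairCount≡0 S j hole)) z≤n
  ... | no j≢p | no j≢q = subst (pairCount S j ≤_) (sym (pairCount-alm-other _ j≢p j≢q))
                            (noSkew⇒pairCount≤1 S j (j≢p ∘ skew⇒p j))
  size<n : size S < n
  size<n = subst₂ _<_ (sym (size-sum S)) (trans (sym (size-sum A)) (alm-size _ p≢q))
    (sum-mono-< S≤A m (subst₂ _<_ (sym (hole⇒pairCount≡0 S m hole-m)) (sym (pairCount-alm-other _ m≢p m≢q)) (s≤s z≤n)))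

almostTransversal⇒alm : {S : Sub n} → AlmostTransversal S → ∃[ p ] ∃[ q ] (p ≢ q × S ≡ alm (starred S) p q)
almostTransversal⇒alm {n} {S} (size≡n , p , skew , skew⇒p) with size≡n-skew⇒hole S size≡n skew
... | q , hole = p , q , p≢q , sub-ext λ x → trans (same x) (sym (mem-alm (starred S) p q x))
  where
  p≢q : p ≢ q
  p≢q refl = true≢false (trans (sym (proj₁ skew)) (proj₁ hole))
  same : ∀ x → mem S x ≡ inAlm (starred S) p q x
  same (m , b) with m ≟ p | m ≟ q
  ... | yes refl | _ = skew-side skew b
  ... | no _ | yes refl = hole-side hole b
  ... | no m≢p | no m≢q =
    noSkew-noHole⇒one-side S m (m≢p ∘ skew⇒p m) (size≡n-oneSkew⇒noOtherHole S size≡n skew⇒p hole p≢q m≢p m≢q) b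

tr-to-alm : ∀ σ {k l : Fin n} {c} → l ≢ k → c ≢ σ l → (tr σ ∖ₛ ⁅ k , σ k ⁆ₛ) ∪ₛ ⁅ l , c ⁆ₛ ≡ alm σ l k
tr-to-alm σ {k} {l} l≢k c≢σl rewrite sym (≢⇒not (≢-sym c≢σl)) = build-∖∪ pointwise
  where
  pointwise : ∀ x → (inTr σ x ∧ not (x == (k , σ k))) ∨ (x == (l , not (σ l))) ≡ inAlm σ l k x
  pointwise (m , b) with m ≟ l | m ≟ k
  ... | yes refl | yes refl = ⊥-elim (l≢k refl)
  ... | yes refl | no _ = ⌊≟⌋∧true-∨-⌊≟not⌋ b (σ m)
  ... | no _ | yes refl = x∧notx∨false ⌊ b Boolₚ.≟ σ m ⌋
  ... | no _ | no _ = x∧true∨false _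

tr-flip : ∀ σ (k : Fin n) {c} → c ≢ σ k → (tr σ ∖ₛ ⁅ k , σ k ⁆ₛ) ∪ₛ ⁅ k , c ⁆ₛ ≡ tr (flip σ k)
tr-flip σ k c≢σk rewrite sym (≢⇒not (≢-sym c≢σk)) = build-∖∪ pointwise
  where
  pointwise : ∀ x → (inTr σ x ∧ not (x == (k , σ k))) ∨ (x == (k , not (σ k))) ≡ inTr (flip σ k) x
  pointwise (m , b) with m ≟ k
  ... | yes refl = cong (_∨ ⌊ b Boolₚ.≟ not (σ m) ⌋) (∧-inverseʳ ⌊ b Boolₚ.≟ σ m ⌋)
  ... | no _ = x∧true∨false _

alm-to-tr : ∀ α {p q : Fin n} → p ≢ q → ∀ b c → (alm α p q ∖ₛ ⁅ p , b ⁆ₛ) ∪ₛ ⁅ q , c ⁆ₛ ≡ tr (reset α p q (not b) c)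
alm-to-tr α {p} {q} p≢q b c = build-∖∪ pointwise
  where
  pointwise : ∀ x → (inAlm α p q x ∧ not (x == (p , b))) ∨ (x == (q , c)) ≡ inTr (reset α p q (not b) c) x
  pointwise (m , d) with m ≟ p | m ≟ q
  ... | yes refl | yes refl = ⊥-elim (p≢q refl)
  ... | yes refl | no _ = trans (∨-identityʳ _) (sym (⌊≟not⌋ d b))
  ... | no _ | yes refl = refl
  ... | no _ | no _ = x∧true∨false _

alm-move-hole : ∀ α {p q l : Fin n} → l ≢ p → l ≢ q →
                (alm α p q ∖ₛ ⁅ l , α l ⁆ₛ) ∪ₛ ⁅ q , not (α q) ⁆ₛ ≡ alm (flip₂ α q l) p l
alm-move-hole α {p} {q} {l} l≢p l≢q = build-∖∪ pointwise
  where
  pointwise : ∀ x → (inAlm α p q x ∧ not (x == (l , α l))) ∨ (x == (q , not (α q))) ≡ inAlm (flip₂ α q l) p l x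
  pointwise (m , b) with m ≟ p | m ≟ q | m ≟ l
  ... | yes refl | _ | yes refl = ⊥-elim (l≢p refl)
  ... | yes refl | _ | no _ = refl
  ... | no _ | yes refl | yes refl = ⊥-elim (l≢q refl)
  ... | no _ | yes refl | no _ = refl
  ... | no _ | no _ | yes refl = x∧notx∨false ⌊ b Boolₚ.≟ α m ⌋
  ... | no _ | no _ | no _ = x∧true∨false _

alm-move-skew : ∀ α {p q l : Fin n} → p ≢ q → l ≢ p → l ≢ q →
                (alm α p q ∖ₛ ⁅ p , α p ⁆ₛ) ∪ₛ ⁅ l , not (α l) ⁆ₛ ≡ alm (flip₂ α p l) l q
alm-move-skew α {p} {q} {l} p≢q l≢p l≢q = build-∖∪ pointwise
  where
  pointwise : ∀ x → (inAlm α p q x ∧ not (x == (p , α p))) ∨ (x == (l , not (α l))) ≡ inAlm (flip₂ α p l) l q x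
  pointwise (m , b) with m ≟ p | m ≟ q | m ≟ l
  ... | yes refl | _ | yes refl = ⊥-elim (l≢p refl)
  ... | yes refl | yes refl | no _ = ⊥-elim (p≢q refl)
  ... | yes refl | no _ | no _ = trans (∨-identityʳ _) (sym (⌊≟not⌋ b (α m)))
  ... | no _ | yes refl | yes refl = ⊥-elim (l≢q refl)
  ... | no _ | yes refl | no _ = refl
  ... | no _ | no _ | yes refl = ⌊≟⌋∧true-∨-⌊≟not⌋ b (α m)
  ... | no _ | no _ | no _ = x∧true∨false _

tr-∪-skew-∖-skew : ∀ τ {i j : Fin n} → i ≢ j → (tr τ ∪ₛ skew i) ∖ₛ skew j ≡ alm τ i j
tr-∪-skew-∖-skew τ {i} {j} i≢j = sub-ext λ (m , b) → begin
  mem ((tr τ ∪ₛ skew i) ∖ₛ skew j) (m , b)                     ≡⟨ mem-∖ _ (skew j) (m , b) ⟩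
  mem (tr τ ∪ₛ skew i) (m , b) ∧ not (mem (skew j) (m , b))    ≡⟨ cong₂ (λ x y → x ∧ not y)
                                                                     (trans (mem-∪ (tr τ) (skew i) (m , b))
                                                                       (cong₂ _∨_ (mem-tr τ m b) (mem-skew i m b)))
                                                                     (mem-skew j m b) ⟩
  (⌊ b Boolₚ.≟ τ m ⌋ ∨ ⌊ m ≟ i ⌋) ∧ not ⌊ m ≟ j ⌋                ≡⟨ pointwise m b ⟩
  inAlm τ i j (m , b)                                          ≡⟨ mem-alm τ i j (m , b) ⟨
  mem (alm τ i j) (m , b)                                      ∎
  where
  open ≡-Reasoning
  mem-skew : ∀ k m b → mem (skew k) (m , b) ≡ ⌊ m ≟ k ⌋
  mem-skew k m b = mem-build (λ x → ⌊ proj₁ x ≟ k ⌋) (m , b)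
  pointwise : ∀ m b → (⌊ b Boolₚ.≟ τ m ⌋ ∨ ⌊ m ≟ i ⌋) ∧ not ⌊ m ≟ j ⌋ ≡ inAlm τ i j (m , b)
  pointwise m b with m ≟ i | m ≟ j
  ... | yes refl | yes refl = ⊥-elim (i≢j refl)
  ... | yes refl | no _ = trans (∧-identityʳ _) (∨-zeroʳ _)
  ... | no _ | yes refl = ∧-zeroʳ _
  ... | no _ | no _ = trans (∧-identityʳ _) (∨-identityʳ _)

tr-△-quad : ∀ β (k l : Fin n) b c → tr β △ₛ quad (k , b) (l , c) ≡ tr (λ m → (⌊ m ≟ k ⌋ ∨ ⌊ m ≟ l ⌋) xor β m)
tr-△-quad {n} β k l b c = sub-ext λ (m , d) → begin
  mem (tr β △ₛ Q) (m , d)                       ≡⟨ mem-build (λ x → mem (tr β) x xor mem Q x) (m , d) ⟩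
  mem (tr β) (m , d) xor mem Q (m , d)          ≡⟨ cong₂ _xor_ (mem-tr β m d) (mem-build inQ (m , d)) ⟩
  ⌊ d Boolₚ.≟ β m ⌋ xor inQ (m , d)              ≡⟨ pointwise m d ⟩
  ⌊ d Boolₚ.≟ (⌊ m ≟ k ⌋ ∨ ⌊ m ≟ l ⌋) xor β m ⌋  ≡⟨ mem-tr _ m d ⟨
  mem (tr _) (m , d)                            ∎
  where
  open ≡-Reasoning
  Q : Sub n
  Q = quad (k , b) (l , c)
  inQ : E n → Bool
  inQ z = (z == (k , b)) ∨ (z == star (k , b)) ∨ (z == (l , c)) ∨ (z == star (l , c))
  xor-true : ∀ d s → ⌊ d Boolₚ.≟ s ⌋ xor true ≡ ⌊ d Boolₚ.≟ not s ⌋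
  xor-true d s = trans (Boolₚ.xor-comm _ true) (sym (⌊≟not⌋ d s))
  pointwise : ∀ m d → ⌊ d Boolₚ.≟ β m ⌋ xor inQ (m , d) ≡ ⌊ d Boolₚ.≟ (⌊ m ≟ k ⌋ ∨ ⌊ m ≟ l ⌋) xor β m ⌋
  pointwise m d with m ≟ k | m ≟ l
  ... | yes _ | _ = trans (cong (⌊ d Boolₚ.≟ β m ⌋ xor_)
                           (trans (sym (Boolₚ.∨-assoc ⌊ d Boolₚ.≟ b ⌋ _ _)) (cong (_∨ _) (⌊≟⌋-∨-⌊≟not⌋ d b))))
                         (xor-true d (β m))
  ... | no _ | yes _ = trans (cong (⌊ d Boolₚ.≟ β m ⌋ xor_) (⌊≟⌋-∨-⌊≟not⌋ d c)) (xor-true d (β m))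
  ... | no _ | no _ = Boolₚ.xor-identityʳ _

tr-∖-noSkew : ∀ σ (e : E n) → NoSkewPair (tr σ ∖ₛ ⁅ e ⁆ₛ)
tr-∖-noSkew σ e i skew = tr-noSkew σ i (skew-∖ (tr σ) e skew)

tr-∪-oneSkew : ∀ σ (k : Fin n) {c} → c ≢ σ k → ExactlyOneSkewPair (tr σ ∪ₛ ⁅ k , c ⁆ₛ)
tr-∪-oneSkew σ k c≢σk rewrite sym (≢⇒not (≢-sym c≢σk)) =
  k , skew-from _ (σ k) (∪⁅⁆-⊇ (tr σ) _ (k , σ k) (tr-self σ k)) (∪⁅⁆-∋ (tr σ) (k , not (σ k))) , unique
  where
  unique : ∀ j → HasSkewAt (tr σ ∪ₛ ⁅ k , not (σ k) ⁆ₛ) j → j ≡ k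
  unique j skew with j ≟ k
  ... | yes j≡k = j≡k
  ... | no j≢k = ⊥-elim (tr-noSkew σ j (skew-∪-other (tr σ) (not (σ k)) j≢k skew))

alm-∖-noSkew : ∀ α {p q : Fin n} b → NoSkewPair (alm α p q ∖ₛ ⁅ p , b ⁆ₛ)
alm-∖-noSkew α {p} {q} b i skew with alm-skew⇒ α (skew-∖ (alm α p q) (p , b) skew)
... | refl = true≢false (trans (sym (skew-side skew b)) (∖⁅⁆-∌ (alm α p q) (p , b)))

alm-∪-oneSkew : ∀ α {p q : Fin n} → p ≢ q → ∀ b → ExactlyOneSkewPair (alm α p q ∪ₛ ⁅ q , b ⁆ₛ)
alm-∪-oneSkew {n} α {p} {q} p≢q b =
  p , skew-∪ (alm α p q) (q , b) (alm-skew α p q) , unique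
  where
  A : Sub n
  A = alm α p q ∪ₛ ⁅ q , b ⁆ₛ
  other-side-absent : (q , not b) ∉ₛ A
  other-side-absent = trans (mem-∪⁅⁆ (alm α p q) (q , b) (q , not b))
    (cong₂ _∨_ (alm-q α p≢q (not b)) (cong₂ _∧_ (⌊⌋-yes (q ≟ q) refl) (⌊⌋-no (not b Boolₚ.≟ b) (not-¬ refl ∘ sym))))
  unique : ∀ j → HasSkewAt A j → j ≡ p
  unique j skew with j ≟ q
  ... | no j≢q = alm-skew⇒ α (skew-∪-other (alm α p q) b j≢q skew)
  ... | yes refl = ⊥-elim (true≢false (trans (sym (skew-side skew (not b))) other-side-absent))

alm-∖-noSkew⇒ : ∀ α {p q k : Fin n} {c} → NoSkewPair (alm α p q ∖ₛ ⁅ k , c ⁆ₛ) → k ≡ p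
alm-∖-noSkew⇒ α {p} {q} {k} {c} noSkew with k ≟ p
... | yes k≡p = k≡p
... | no k≢p = ⊥-elim (noSkew p (kept false , kept true))
  where
  kept : ∀ b → (p , b) ∈ₛ (alm α p q ∖ₛ ⁅ k , c ⁆ₛ)
  kept b = trans (mem-∖⁅⁆ (alm α p q) (k , c) (p , b))
    (cong₂ (λ x y → x ∧ not (y ∧ ⌊ b Boolₚ.≟ c ⌋)) (alm-p α p q b) (⌊⌋-no (p ≟ k) (≢-sym k≢p)))

alm-∪-oneSkew⇒ : ∀ α {p q k : Fin n} {c} → (k , c) ∉ₛ alm α p q →
                 ExactlyOneSkewPair (alm α p q ∪ₛ ⁅ k , c ⁆ₛ) → k ≡ q
alm-∪-oneSkew⇒ {n} α {p} {q} {k} {c} k∉ (i , _ , unique) with k ≟ q | k ≟ p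
... | yes k≡q | _ = k≡q
... | no _ | yes refl = ⊥-elim (true≢false (trans (sym (alm-p α k q c)) k∉))
... | no k≢q | no k≢p = ⊥-elim (k≢p (trans (unique k skew-k) (sym (unique p skew-p))))
  where
  A : Sub n
  A = alm α p q
  c≢αk : c ≢ α k
  c≢αk = tr-∉ α (trans (sym (alm-other α k≢p k≢q c)) k∉)
  αk≡notc : α k ≡ not c
  αk≡notc = sym (≢⇒not c≢αk)
  skew-k : HasSkewAt (A ∪ₛ ⁅ k , c ⁆ₛ) k
  skew-k = skew-from _ c (∪⁅⁆-∋ A (k , c))
    (∪⁅⁆-⊇ A (k , c) (k , not c)
      (trans (alm-other α k≢p k≢q (not c)) (subst (λ b → (k , b) ∈ₛ tr α) αk≡notc (tr-self α k))))
  skew-p : HasSkewAt (A ∪ₛ ⁅ k , c ⁆ₛ) p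
  skew-p = skew-∪ A (k , c) (alm-skew α p q)

sizeUnstarred-tr : ∀ σ → sizeUnstarred {n} (tr σ) ≡ sum (λ m → bit (not (σ m)))
sizeUnstarred-tr σ =
  trans (countV-sum (proj₁ (tr σ))) (sum-cong-≗ λ m → cong bit (trans (mem-tr σ m false) (⌊false≟⌋ (σ m))))

sizeUnstarred-flip : ∀ σ (k : Fin n) → sizeUnstarred (tr (flip σ k)) % 2 ≢ sizeUnstarred (tr σ) % 2
sizeUnstarred-flip σ k rewrite sizeUnstarred-tr (flip σ k) | sizeUnstarred-tr σ =
  %2-differ _ _ (not (σ k)) (trans (sum-differ-at k agree) (cong (λ b → _ + bit (not b)) (flip-at σ k)))
  where
  agree : ∀ m → m ≢ k → bit (not (flip σ k m)) ≡ bit (not (σ m))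
  agree m m≢k = cong (bit ∘ not) (flip-off σ m≢k)

-- The even symmetric matroid and its almost-transversal completion

module EvenSymmetricMatroid {n : ℕ} {𝓑 : Family n} (symmetric : IsSymmetricMatroid 𝓑) (even : IsEven 𝓑) where
  open IsSymmetricMatroid symmetric

  Feasible : Vector Bool n → Set
  Feasible σ = tr σ ∈𝓕 𝓑

  feasible-resp : ∀ {σ τ} → σ ≗ τ → Feasible σ → Feasible τ
  feasible-resp σ≗τ = subst (_∈𝓕 𝓑) (tr-cong σ≗τ)

  ¬feasible-flip : ∀ {σ} → Feasible σ → ∀ k → ¬ Feasible (flip σ k)
  ¬feasible-flip {σ} Fσ k Fσk = sizeUnstarred-flip σ k (even _ _ Fσk Fσ)

  feasible-exchange : ∀ {β β′} → Feasible β → Feasible β′ → ∀ {k} → β k ≢ β′ k →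
                      ∃[ l ] (l ≢ k × β l ≢ β′ l × Feasible (flip₂ β k l))
  feasible-exchange {β} {β′} Fβ Fβ′ {k} βk≢β′k
    with exchange (tr β) (tr β′) Fβ Fβ′ (k , β k) (tr-self β k) (tr-other β′ βk≢β′k)
  ... | (l , d) , y∈β , y∉β′ , F△ with tr-∈ β {l} {d} y∈β
  ... | refl = l , l≢k , tr-∉ β′ y∉β′ , feasible-resp (quad-flip₂ l≢k) F△′
    where
    F△′ : Feasible (λ m → (⌊ m ≟ k ⌋ ∨ ⌊ m ≟ l ⌋) xor β m)
    F△′ = subst (_∈𝓕 𝓑) (tr-△-quad β k l (β k) (β l)) F△
    l≢k : l ≢ k
    l≢k refl = ¬feasible-flip Fβ k (feasible-resp quad-flip F△′)
      where
      quad-flip : (λ m → (⌊ m ≟ k ⌋ ∨ ⌊ m ≟ k ⌋) xor β m) ≗ flip β k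
      quad-flip m = cong (_xor β m) (Boolₚ.∨-idem ⌊ m ≟ k ⌋)
    quad-flip₂ : l ≢ k → (λ m → (⌊ m ≟ k ⌋ ∨ ⌊ m ≟ l ⌋) xor β m) ≗ flip₂ β k l
    quad-flip₂ l≢k m with m ≟ k | m ≟ l
    ... | yes refl | yes refl = ⊥-elim (l≢k refl)
    ... | yes _ | no _ = refl
    ... | no _ | yes _ = refl
    ... | no _ | no _ = refl

  open SimultaneousExchange Feasible feasible-resp feasible-exchange using (simultaneous-exchange)

  Admissible : Vector Bool n → Fin n → Fin n → Set
  Admissible α p q = p ≢ q × Feasible α × Feasible (flip₂ α p q)

  IsAlmostBasis : Sub n → Set
  IsAlmostBasis A = ∃[ α ] ∃[ p ] ∃[ q ] (Admissible α p q × A ≡ alm α p q)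

  -- Since alm α p q does not depend on α p and α q, only four choices of α need to be tried.
  isAlmostBasis? : ∀ A → Dec (IsAlmostBasis A)
  isAlmostBasis? A = map′ found complete (Finₚ.any? λ p → Finₚ.any? λ q → ∃Bool? λ b → ∃Bool? λ c → candidate? p q b c)
    where
    guess : Fin n → Fin n → Bool → Bool → Vector Bool n
    guess = reset (starred A)
    Candidate : Fin n → Fin n → Bool → Bool → Set
    Candidate p q b c = Admissible (guess p q b c) p q × A ≡ alm (guess p q b c) p q
    feasible? : ∀ σ → Dec (Feasible σ)
    feasible? σ = 𝓑 (tr σ) Boolₚ.≟ true
    candidate? : ∀ p q b c → Dec (Candidate p q b c)
    candidate? p q b c = (¬? (p ≟ q) ×-dec feasible? _ ×-dec feasible? _) ×-dec (A ≟ₛ alm (guess p q b c) p q)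
    found : (∃[ p ] ∃[ q ] ∃[ b ] ∃[ c ] Candidate p q b c) → IsAlmostBasis A
    found (p , q , b , c , candidate) = guess p q b c , p , q , candidate
    complete : IsAlmostBasis A → ∃[ p ] ∃[ q ] ∃[ b ] ∃[ c ] Candidate p q b c
    complete (α , p , q , (p≢q , Fα , Fα′) , refl) =
      p , q , α p , α q ,
      (p≢q , feasible-resp (sym ∘ α≗) Fα , feasible-resp (flip-cong q (flip-cong p (sym ∘ α≗))) Fα′) ,
      alm-cong (λ m m≢p m≢q → sym (α≗ m))
      where
      α≗ : guess p q (α p) (α q) ≗ α
      α≗ m with m ≟ p | m ≟ q
      ... | yes refl | _ = refl
      ... | no _ | yes refl = refl
      ... | no m≢p | no m≢q = starred-alm α m≢p m≢q

  -- Abstract, so that the search deciding 𝓑′ is never unfolded during type checking.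
  abstract
    𝓑′ : Family n
    𝓑′ A = ⌊ isAlmostBasis? A ⌋

    𝓑′-intro : ∀ {A} → IsAlmostBasis A → A ∈𝓕 𝓑′
    𝓑′-intro {A} = ⌊⌋-yes (isAlmostBasis? A)

    𝓑′-elim : ∀ {A} → A ∈𝓕 𝓑′ → IsAlmostBasis A
    𝓑′-elim {A} = ⌊⌋-sound (isAlmostBasis? A)

  admissible⇒𝓑′ : ∀ {α p q} → Admissible α p q → alm α p q ∈𝓕 𝓑′
  admissible⇒𝓑′ a = 𝓑′-intro (_ , _ , _ , a , refl)

  𝓑′⊆𝒜 : ∀ X → X ∈𝓕 𝓑′ → AlmostTransversal X
  𝓑′⊆𝒜 X h with 𝓑′-elim h
  ... | α , p , q , (p≢q , _) , refl = alm-almostTransversal α p≢q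

  𝓑″ : Family n
  𝓑″ = 𝓑 ∪𝓕 𝓑′

  data Member (B : Sub n) : Set where
    transversal : ∀ {β} → Feasible β → B ≡ tr β → Member B
    almost : ∀ {α p q} → Admissible α p q → B ≡ alm α p q → Member B

  member : ∀ {B} → B ∈𝓕 𝓑″ → Member B
  member {B} B∈𝓑″ with ∪𝓕-elim 𝓑 𝓑′ B B∈𝓑″
  ... | inj₁ B∈𝓑 = transversal (subst (_∈𝓕 𝓑) B≡ B∈𝓑) B≡
    where
    B≡ : B ≡ tr (starred B)
    B≡ = transversal⇒tr (transversals B B∈𝓑)
  ... | inj₂ B∈𝓑′ with 𝓑′-elim B∈𝓑′
  ...   | α , p , q , a , B≡ = almost a B≡

  tr∈𝓑″ : ∀ {σ} → Feasible σ → tr σ ∈𝓕 𝓑″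
  tr∈𝓑″ = ∪𝓕-introˡ 𝓑 𝓑′

  alm∈𝓑″ : ∀ {α p q} → Admissible α p q → alm α p q ∈𝓕 𝓑″
  alm∈𝓑″ = ∪𝓕-introʳ 𝓑 𝓑′ ∘ admissible⇒𝓑′

  tr-exchange∈𝓑″ : ∀ {σ k l c} → Feasible σ → l ≢ k → Feasible (flip₂ σ k l) → c ≢ σ l →
                   ((tr σ ∖ₛ ⁅ k , σ k ⁆ₛ) ∪ₛ ⁅ l , c ⁆ₛ) ∈𝓕 𝓑″
  tr-exchange∈𝓑″ {σ} {k} {l} Fσ l≢k Fσkl c≢σl =
    subst (_∈𝓕 𝓑″) (sym (tr-to-alm σ l≢k c≢σl)) (alm∈𝓑″ (l≢k , Fσ , feasible-resp (flip₂-comm σ k l) Fσkl))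

  move-skew∈𝓑″ : ∀ {α p q l c} → Admissible α p q → l ≢ p → Feasible (flip₂ α p l) → c ≢ α l →
                 ((alm α p q ∖ₛ ⁅ p , α p ⁆ₛ) ∪ₛ ⁅ l , c ⁆ₛ) ∈𝓕 𝓑″
  move-skew∈𝓑″ {α} {p} {q} {l} (p≢q , Fα , Fαpq) l≢p Fαpl c≢αl
    rewrite sym (≢⇒not (≢-sym c≢αl)) with l ≟ q
  ... | yes refl = subst (_∈𝓕 𝓑″) (sym (alm-to-tr α p≢q (α p) (not (α l))))
                     (tr∈𝓑″ (feasible-resp (sym ∘ reset-flip₂ α p≢q) Fαpq))
  ... | no l≢q = subst (_∈𝓕 𝓑″) (sym (alm-move-skew α p≢q l≢p l≢q))
                   (alm∈𝓑″ (l≢q , Fαpl , feasible-resp (sym ∘ flip₂-chain α p l q) Fαpq))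

  move-hole∈𝓑″ : ∀ {α p q l c} → Admissible α p q → l ≢ q → Feasible (flip₂ α q l) → c ≢ α q →
                 ((alm α p q ∖ₛ ⁅ l , α l ⁆ₛ) ∪ₛ ⁅ q , c ⁆ₛ) ∈𝓕 𝓑″
  move-hole∈𝓑″ {α} {p} {q} {l} (p≢q , Fα , Fαpq) l≢q Fαql c≢αq
    rewrite sym (≢⇒not (≢-sym c≢αq)) with l ≟ p
  ... | yes refl = subst (_∈𝓕 𝓑″) (sym (alm-to-tr α p≢q (α l) (not (α q))))
                     (tr∈𝓑″ (feasible-resp (sym ∘ reset-flip₂ α p≢q) Fαpq))
  ... | no l≢p = subst (_∈𝓕 𝓑″) (sym (alm-move-hole α l≢p l≢q))
                   (alm∈𝓑″ (≢-sym l≢p , Fαql , feasible-resp (sym ∘ flip₂-chain′ α q l p) Fαpq))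

  exchange-via : ∀ {B B′ e} f → f ∈ₛ B′ → f ∉ₛ B → e ∉ₛ B′ →
                 ((B ∖ₛ ⁅ e ⁆ₛ) ∪ₛ ⁅ f ⁆ₛ) ∈𝓕 𝓑″ → ((B′ ∖ₛ ⁅ f ⁆ₛ) ∪ₛ ⁅ e ⁆ₛ) ∈𝓕 𝓑″ → Exchange 𝓑″ B B′ e
  exchange-via {B′ = B′} {e} f f∈B′ f∉B e∉B′ B-side B′-side =
    f , f∈B′ , f∉B , B-side , subst (_∈𝓕 𝓑″) (sym (∪∖-comm e≢f B′)) B′-side
    where
    e≢f : e ≢ f
    e≢f refl = true≢false (trans (sym f∈B′) e∉B′)

  exchange-tr-tr : ∀ {β β′ k} → Feasible β → Feasible β′ → β k ≢ β′ k → Exchange 𝓑″ (tr β) (tr β′) (k , β k)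
  exchange-tr-tr {β} {β′} {k} Fβ Fβ′ βk≢β′k with simultaneous-exchange Fβ Fβ′ βk≢β′k
  ... | l , l≢k , βl≢β′l , Fβkl , Fβ′kl =
    exchange-via (l , β′ l) (tr-self β′ l) (tr-other β (≢-sym βl≢β′l)) (tr-other β′ βk≢β′k)
      (tr-exchange∈𝓑″ Fβ l≢k Fβkl (≢-sym βl≢β′l))
      (tr-exchange∈𝓑″ Fβ′ (≢-sym l≢k) (feasible-resp (flip₂-comm β′ k l) Fβ′kl) βk≢β′k)

  exchange-tr-alm : ∀ {β α p q} → Feasible β → Admissible α p q → α q ≢ β q → Exchange 𝓑″ (tr β) (alm α p q) (q , β q)
  exchange-tr-alm {β} {α} {p} {q} Fβ a@(p≢q , Fα , _) αq≢βq with simultaneous-exchange Fβ Fα (≢-sym αq≢βq)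
  ... | l , l≢q , βl≢αl , Fβql , Fαql =
    exchange-via (l , α l) (alm-∋ α l≢q) (tr-other β (≢-sym βl≢αl)) (alm-q α p≢q (β q))
      (tr-exchange∈𝓑″ Fβ l≢q Fβql (≢-sym βl≢αl))
      (move-hole∈𝓑″ a l≢q Fαql (≢-sym αq≢βq))

  exchange-alm-tr : ∀ {α p q β} → Admissible α p q → Feasible β → α p ≢ β p → Exchange 𝓑″ (alm α p q) (tr β) (p , α p)
  exchange-alm-tr {α} {p} {q} {β} a@(p≢q , Fα , _) Fβ αp≢βp with simultaneous-exchange Fβ Fα (≢-sym αp≢βp)
  ... | l , l≢p , βl≢αl , Fβpl , Fαpl =
    exchange-via (l , β l) (tr-self β l) (alm-∌ α p≢q l≢p βl≢αl) (tr-other β αp≢βp)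
      (move-skew∈𝓑″ a l≢p Fαpl βl≢αl)
      (tr-exchange∈𝓑″ Fβ (≢-sym l≢p) (feasible-resp (flip₂-comm β p l) Fβpl) αp≢βp)

  exchange-alm-alm : ∀ {X p₁ q₁ Y p₂} → Admissible X p₁ q₁ → Admissible Y p₂ p₁ → X p₁ ≢ Y p₁ →
                     Exchange 𝓑″ (alm X p₁ q₁) (alm Y p₂ p₁) (p₁ , X p₁)
  exchange-alm-alm {X} {p₁} {q₁} {Y} {p₂} aX@(p₁≢q₁ , FX , _) aY@(p₂≢p₁ , FY , _) Xp₁≢Yp₁
    with simultaneous-exchange FX FY Xp₁≢Yp₁
  ... | l , l≢p₁ , Xl≢Yl , FXp₁l , FYp₁l =
    exchange-via (l , Y l) (alm-∋ Y l≢p₁) (alm-∌ X p₁≢q₁ l≢p₁ (≢-sym Xl≢Yl)) (alm-q Y p₂≢p₁ (X p₁))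
      (move-skew∈𝓑″ aX l≢p₁ FXp₁l (≢-sym Xl≢Yl))
      (move-hole∈𝓑″ aY l≢p₁ FYp₁l Xp₁≢Yp₁)

  -- alm α p q = alm (flip₂ α p q) p q, and both representatives are admissible.
  wlog : ∀ {P : Sub n → Set} {α p q i} → i ≡ p ⊎ i ≡ q → ∀ v → Admissible α p q →
         (∀ {α′} → Admissible α′ p q → α′ i ≡ v → P (alm α′ p q)) → P (alm α p q)
  wlog {P} {α} {p} {q} {i} i∈ v a@(p≢q , Fα , Fαpq) k with α i Boolₚ.≟ v
  ... | yes αi≡v = k a αi≡v
  ... | no αi≢v = subst P (alm-flip₂ α p q)
      (k (p≢q , Fαpq , feasible-resp (sym ∘ flip₂-involutive α p q) Fα) (trans (flipped i∈) (≢⇒not αi≢v)))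
    where
    flipped : i ≡ p ⊎ i ≡ q → flip₂ α p q i ≡ not (α i)
    flipped (inj₁ refl) = flip₂-atˡ α p≢q
    flipped (inj₂ refl) = flip₂-atʳ α p≢q

  exchange-members : ∀ {B B′} → Member B → Member B′ → ∀ e → e ∈ₛ B → e ∉ₛ B′ →
              NoSkewPair (B ∖ₛ ⁅ e ⁆ₛ) → ExactlyOneSkewPair (B′ ∪ₛ ⁅ e ⁆ₛ) → Exchange 𝓑″ B B′ e
  exchange-members (transversal {β} Fβ refl) (transversal {β′} Fβ′ refl) (k , b) e∈ e∉ _ _ with tr-∈ β {k} {b} e∈
  ... | refl = exchange-tr-tr Fβ Fβ′ (tr-∉ β′ e∉)
  exchange-members (transversal {β} Fβ refl) (almost {α} {p} {q} a refl) (k , b) e∈ e∉ _ oneSkew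
    with tr-∈ β {k} {b} e∈ | alm-∪-oneSkew⇒ α e∉ oneSkew
  ... | refl | refl = wlog {P = λ A → Exchange 𝓑″ (tr β) A (q , β q)} (inj₂ refl) (not (β q)) a λ a′ α′q≡ →
    exchange-tr-alm Fβ a′ (λ α′q≡βq → not-¬ refl (trans (sym α′q≡βq) α′q≡))
  exchange-members (almost {α} {p} {q} a refl) (transversal {β} Fβ refl) (k , c) e∈ e∉ noSkew _
    with alm-∖-noSkew⇒ α noSkew
  ... | refl = wlog {P = λ A → Exchange 𝓑″ A (tr β) (p , c)} (inj₁ refl) c a λ {α′} a′ α′p≡c →
    subst (λ c → Exchange 𝓑″ (alm α′ p q) (tr β) (p , c)) α′p≡c (exchange-alm-tr a′ Fβ (tr-∉ β e∉ ∘ trans (sym α′p≡c)))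
  exchange-members (almost {X} {p₁} {q₁} aX refl) (almost {Y} {p₂} {q₂} aY refl) (k , c) e∈ e∉ noSkew oneSkew
    with alm-∖-noSkew⇒ X noSkew | alm-∪-oneSkew⇒ Y e∉ oneSkew
  ... | refl | refl =
    wlog {P = λ A → Exchange 𝓑″ A (alm Y p₂ p₁) (p₁ , c)} (inj₁ refl) c aX λ {X′} aX′ X′p₁≡c →
    wlog {P = λ A → Exchange 𝓑″ (alm X′ p₁ q₁) A (p₁ , c)} (inj₂ refl) (not c) aY λ {Y′} aY′ Y′p₁≡ →
    subst (λ c → Exchange 𝓑″ (alm X′ p₁ q₁) (alm Y′ p₂ p₁) (p₁ , c)) X′p₁≡c
      (exchange-alm-alm aX′ aY′ (λ X′p₁≡Y′p₁ → not-¬ refl (trans (sym X′p₁≡c) (trans X′p₁≡Y′p₁ Y′p₁≡))))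

  swap-almost : ∀ {τ i j} → i ≢ j → alm τ i j ∈𝓕 𝓑″ → alm τ j i ∈𝓕 𝓑″
  swap-almost {τ} {i} {j} i≢j h with member h
  ... | transversal {β} _ eq = ⊥-elim (tr-noSkew β i (subst (λ S → HasSkewAt S i) eq (alm-skew τ i j)))
  ... | almost {α} (_ , Fα , Fαij) eq with alm-injective i≢j eq
  ...   | refl , refl , τ≡α = subst (_∈𝓕 𝓑″) (alm-cong λ m m≢j m≢i → sym (τ≡α m m≢i m≢j))
                                (alm∈𝓑″ (≢-sym i≢j , Fα , feasible-resp (flip₂-comm α i j) Fαij))

  𝓑″-B2 : ∀ T → Transversal T → (i j : Fin n) → ¬ (i ≡ j) →
              (((T ∪ₛ skew i) ∖ₛ skew j) ∈𝓕 𝓑″ → ((T ∪ₛ skew j) ∖ₛ skew i) ∈𝓕 𝓑″) ×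
              (((T ∪ₛ skew j) ∖ₛ skew i) ∈𝓕 𝓑″ → ((T ∪ₛ skew i) ∖ₛ skew j) ∈𝓕 𝓑″)
  𝓑″-B2 T T-tr i j i≢j = swap i≢j , swap (≢-sym i≢j)
    where
    T≡ : ∀ {i j} → i ≢ j → (T ∪ₛ skew i) ∖ₛ skew j ≡ alm (starred T) i j
    T≡ {i} {j} i≢j =
      trans (cong (λ S → (S ∪ₛ skew i) ∖ₛ skew j) (transversal⇒tr {S = T} T-tr)) (tr-∪-skew-∖-skew _ i≢j)
    swap : ∀ {i j} → i ≢ j → ((T ∪ₛ skew i) ∖ₛ skew j) ∈𝓕 𝓑″ → ((T ∪ₛ skew j) ∖ₛ skew i) ∈𝓕 𝓑″
    swap i≢j h = subst (_∈𝓕 𝓑″) (sym (T≡ (≢-sym i≢j))) (swap-almost i≢j (subst (_∈𝓕 𝓑″) (T≡ i≢j) h))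

  𝓑″-antisymmetric : IsAntisymmetricMatroid 𝓑″
  𝓑″-antisymmetric = record
    { ⊆𝒯∪𝒜 = λ B B∈𝓑″ → shape (member B∈𝓑″)
    ; B1 = proj₁ nonempty , ∪𝓕-introˡ 𝓑 𝓑′ (proj₂ nonempty)
    ; B2 = 𝓑″-B2
    ; Exch = λ B B′ B∈𝓑″ B′∈𝓑″ → exchange-members (member B∈𝓑″) (member B′∈𝓑″)
    }
    where
    shape : ∀ {B} → Member B → Transversal B ⊎ AlmostTransversal B
    shape (transversal {β} _ refl) = inj₁ (tr-transversal β)
    shape (almost {α} (p≢q , _) refl) = inj₂ (alm-almostTransversal α p≢q)

  module Unique (𝓒 : Family n) (𝓒⊆𝒜 : ∀ X → X ∈𝓕 𝓒 → AlmostTransversal X)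
                (antisymmetric : IsAntisymmetricMatroid (𝓑 ∪𝓕 𝓒)) where
    open IsAntisymmetricMatroid antisymmetric using (B2; Exch)

    𝓒″ : Family n
    𝓒″ = 𝓑 ∪𝓕 𝓒

    tr∈𝓒″⇒feasible : ∀ {σ} → tr σ ∈𝓕 𝓒″ → Feasible σ
    tr∈𝓒″⇒feasible {σ} σ∈𝓒″ with ∪𝓕-elim 𝓑 𝓒 (tr σ) σ∈𝓒″
    ... | inj₁ σ∈𝓑 = σ∈𝓑
    ... | inj₂ σ∈𝓒 with 𝓒⊆𝒜 (tr σ) σ∈𝓒
    ...   | _ , i , skew , _ = ⊥-elim (tr-noSkew σ i skew)

    alm∈𝓒″⇒alm∈𝓒 : ∀ {α p q} → alm α p q ∈𝓕 𝓒″ → alm α p q ∈𝓕 𝓒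
    alm∈𝓒″⇒alm∈𝓒 {α} {p} {q} A∈𝓒″ with ∪𝓕-elim 𝓑 𝓒 (alm α p q) A∈𝓒″
    ... | inj₁ A∈𝓑 = ⊥-elim (proj₂ (transversals _ A∈𝓑) p (alm-skew α p q))
    ... | inj₂ A∈𝓒 = A∈𝓒

    -- Exchanging (q , α q) between the bases tr α and tr (flip₂ α p q) can only produce alm α p q.
    𝓑′⊆𝓒 : ∀ {X} → X ∈𝓕 𝓑′ → X ∈𝓕 𝓒
    𝓑′⊆𝓒 X∈𝓑′ with 𝓑′-elim X∈𝓑′
    ... | α , p , q , (p≢q , Fα , Fα′) , refl = from-exchange
      (Exch (tr α) (tr α′) (∪𝓕-introˡ 𝓑 𝓒 Fα) (∪𝓕-introˡ 𝓑 𝓒 Fα′) (q , α q) (tr-self α q) (tr-other α′ αq≢α′q)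
            (tr-∖-noSkew α (q , α q)) (tr-∪-oneSkew α′ q αq≢α′q))
      where
      α′ : Vector Bool n
      α′ = flip₂ α p q
      αq≢α′q : α q ≢ α′ q
      αq≢α′q αq≡α′q = not-¬ refl (trans αq≡α′q (flip₂-atʳ α p≢q))
      from-exchange : Exchange 𝓒″ (tr α) (tr α′) (q , α q) → alm α p q ∈𝓕 𝓒
      from-exchange ((l , d) , f∈ , f∉ , left , _) with tr-∈ α′ {l} {d} f∈
      ... | refl with flip₂-support α α {p} {q} {l} (tr-∉ α f∉)
      ...   | inj₁ refl = ⊥-elim (¬feasible-flip Fα q (tr∈𝓒″⇒feasible (subst (_∈𝓕 𝓒″) (tr-flip α q (tr-∉ α f∉)) left)))
      ...   | inj₂ (inj₁ refl) = alm∈𝓒″⇒alm∈𝓒 (subst (_∈𝓕 𝓒″) (tr-to-alm α p≢q (tr-∉ α f∉)) left)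
      ...   | inj₂ (inj₂ α′l≢α′l) = ⊥-elim (α′l≢α′l refl)

    swap∈𝓒″ : ∀ {ρ p q} → p ≢ q → alm ρ p q ∈𝓕 𝓒″ → alm ρ q p ∈𝓕 𝓒″
    swap∈𝓒″ {ρ} {p} {q} p≢q A∈𝓒″ = subst (_∈𝓕 𝓒″) (tr-∪-skew-∖-skew ρ (≢-sym p≢q))
      (proj₁ (B2 (tr ρ) (tr-transversal ρ) p q p≢q) (subst (_∈𝓕 𝓒″) (sym (tr-∪-skew-∖-skew ρ p≢q)) A∈𝓒″))

    -- Exchanging (p , true) between alm ρ p q and alm ρ q p yields two bases of 𝓑 that witness alm ρ p q ∈ 𝓑′.
    alm∈𝓒″⇒alm∈𝓑′ : ∀ {ρ p q} → p ≢ q → alm ρ p q ∈𝓕 𝓒″ → alm ρ p q ∈𝓕 𝓑′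
    alm∈𝓒″⇒alm∈𝓑′ {ρ} {p} {q} p≢q A∈𝓒″ = from-exchange
      (Exch (alm ρ p q) (alm ρ q p) A∈𝓒″ (swap∈𝓒″ p≢q A∈𝓒″) (p , true) (alm-p ρ p q true) (alm-q ρ q≢p true)
            (alm-∖-noSkew ρ true) (alm-∪-oneSkew ρ q≢p true))
      where
      q≢p : q ≢ p
      q≢p = ≢-sym p≢q
      from-exchange : Exchange 𝓒″ (alm ρ p q) (alm ρ q p) (p , true) → alm ρ p q ∈𝓕 𝓑′
      from-exchange ((l , d) , f∈ , f∉ , left , right) with alm-swap-difference ρ {p} {q} {l} {d} p≢q f∈ f∉
      ... | refl = subst (_∈𝓕 𝓑′) (alm-reset ρ false d) (admissible⇒𝓑′ (p≢q , Fα , feasible-resp α′≗ Fα′))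
        where
        Fα : Feasible (reset ρ p q false d)
        Fα = tr∈𝓒″⇒feasible (subst (_∈𝓕 𝓒″) (alm-to-tr ρ p≢q true d) left)
        Fα′ : Feasible (reset ρ q p (not d) true)
        Fα′ = tr∈𝓒″⇒feasible
          (subst (_∈𝓕 𝓒″) (trans (∪∖-comm {e = p , true} {q , d} (p≢q ∘ cong proj₁) (alm ρ q p))
                                   (alm-to-tr ρ q≢p d true)) right)
        α′≗ : reset ρ q p (not d) true ≗ flip₂ (reset ρ p q false d) p q
        α′≗ m with m ≟ p | m ≟ q
        ... | yes refl | yes refl = ⊥-elim (p≢q refl)
        ... | yes refl | no _ = refl
        ... | no _ | yes refl = refl
        ... | no _ | no _ = refl

    𝓒⊆𝓑′ : ∀ {X} → X ∈𝓕 𝓒 → X ∈𝓕 𝓑′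
    𝓒⊆𝓑′ {X} X∈𝓒 with almostTransversal⇒alm (𝓒⊆𝒜 X X∈𝓒)
    ... | p , q , p≢q , X≡ = subst (_∈𝓕 𝓑′) (sym X≡) (alm∈𝓒″⇒alm∈𝓑′ p≢q (subst (_∈𝓕 𝓒″) X≡ (∪𝓕-introʳ 𝓑 𝓒 X∈𝓒)))

    𝓒≡𝓑′ : ∀ X → 𝓒 X ≡ 𝓑′ X
    𝓒≡𝓑′ X = Boolₚ.⇔→≡ (mk⇔ 𝓒⊆𝓑′ 𝓑′⊆𝓒)

theorem4p13 : (n : ℕ) (𝓑 : Family n) → IsEvenSymmetricMatroid 𝓑 →
    ∃[ 𝓑' ] (((∀ X → X ∈𝓕 𝓑' → AlmostTransversal X) × IsAntisymmetricMatroid (𝓑 ∪𝓕 𝓑')) ×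
             ((𝓒 : Family n) → (∀ X → X ∈𝓕 𝓒 → AlmostTransversal X) → IsAntisymmetricMatroid (𝓑 ∪𝓕 𝓒) →
              ∀ X → 𝓒 X ≡ 𝓑' X))
theorem4p13 n 𝓑 (symmetric , even) =
  𝓑′ , (𝓑′⊆𝒜 , 𝓑″-antisymmetric) , λ 𝓒 𝓒⊆𝒜 antisymmetric → Unique.𝓒≡𝓑′ 𝓒 𝓒⊆𝒜 antisymmetric
  where open EvenSymmetricMatroid symmetric even
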